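{- Let $q$ be even, $\sigma\in GF(q)$ with $x^2+\sigma x+1$ irreducible over $GF(q)$, let $\mathcal{C}$ be the conic $\{X_2=0\}\cap\{X_0X_3+X_1^2+\sigma X_1X_2+X_2^2=0\}$ of $PG(3,q)\subset PG(3,q^2)$, with nucleus $N=(0,1,0,0)$, and let $G$ be the group of projectivities with matrices $\begin{pmatrix} a^2 & 0 & \sigma ab & b^2\\ ac & 1 & \sigma bc & bd\\ 0&0&1&0\\ c^2 & 0 & \sigma cd & d^2\end{pmatrix}$, $a,b,c,d\in GF(q)$, $ad+bc=1$. Let $PSp(4,q)$ be the group of projectivities with matrices over $GF(q)$ preserving the alternating form $X_0Y_3+X_3Y_0+\sigma(X_1Y_2+X_2Y_1)$, and $\tau:(X_i)\mapsto(X_i^q)$ acting on $PG(3,q^2)$. Then the stabilizer of $\mathcal{C}$ in $\langle PSp(4,q),\tau\rangle$ is $G\times T\times\{1,\tau\}$, where $T$ is the group of symplectic transvections centred on $N$.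
   Context: The symplectic transvections centred on $N$ are the projectivities $(X_0,X_1,X_2,X_3)\mapsto(X_0,X_1+vX_2,X_2,X_3)$, $v\in GF(q)$. -}

module Defs where

open import Level using (0ℓ)
open import Data.Nat using (ℕ; zero; suc)
open import Data.Bool using (Bool; true; false)
open import Data.Fin using (Fin)
open import Data.Fin.Patterns using (0F; 1F; 2F; 3F)
open import Data.Vec using (Vec; []; _∷_; lookup)
open import Data.Product using (Σ; _×_; _,_; ∃)
open import Function.Bundles using (_↔_; _⇔_)
open import Relation.Nullary using (¬_)
open import Relation.Binary.PropositionalEquality using (_≡_)
open import Algebra.Structures using (IsCommutativeRing)

record Field : Set₁ where
  infixl 7 _*_
  infixl 6 _+_
  field
    Carrier : Set
    _+_ _*_ : Carrier → Carrier → Carrier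
    -_      : Carrier → Carrier
    0# 1#   : Carrier
    isCommutativeRing : IsCommutativeRing _≡_ _+_ _*_ -_ 0# 1#
    0≢1     : ¬ (0# ≡ 1#)
    inverse : ∀ x → ¬ (x ≡ 0#) → Σ Carrier (λ y → x * y ≡ 1#)

HasSize : Field → ℕ → Set
HasSize K n = Fin n ↔ Field.Carrier K

-- Everything below is relative to a field K (playing GF(q^2)) and q.

module Geometry (K : Field) (q : ℕ) where
  open Field K renaming (Carrier to F)

  _^_ : F → ℕ → F
  x ^ zero  = 1#
  x ^ suc n = x * (x ^ n)

  InGFq : F → Set
  InGFq x = x ^ q ≡ x

  -- x^2 + σ x + 1 irreducible over GF(q): it has no factorisation
  -- (x + r)(x + s) with r, s ∈ GF(q) (a monic quadratic is reducible
  -- iff it is a product of two monic linear factors)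
  IrreducibleOverGFq : F → Set
  IrreducibleOverGFq σ =
    ∀ r s → InGFq r → InGFq s → ¬ ((r + s ≡ σ) × (r * s ≡ 1#))

  V4 : Set
  V4 = Fin 4 → F

  Mat : Set
  Mat = Fin 4 → Fin 4 → F

  mkMat : Vec (Vec F 4) 4 → Mat
  mkMat rows i j = lookup (lookup rows i) j

  _·_ : Mat → V4 → V4
  (M · x) i = M i 0F * x 0F + M i 1F * x 1F + M i 2F * x 2F + M i 3F * x 3F

  NonZero : V4 → Set
  NonZero x = ¬ (∀ i → x i ≡ 0#)

  _∼_ : V4 → V4 → Set
  x ∼ y = Σ F (λ λ' → ¬ (λ' ≡ 0#) × (∀ i → x i ≡ λ' * y i))

  SameMap : (V4 → V4) → (V4 → V4) → Set
  SameMap f g = ∀ x → NonZero x → f x ∼ g x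

  -- τ : (X_i) ↦ (X_i^q), applied e times (e ∈ {0,1})
  frob : Bool → V4 → V4
  frob false x = x
  frob true  x i = x i ^ q

  act : Mat → Bool → V4 → V4
  act M e x = M · frob e x

  module WithSigma (σ : F) where

    B : V4 → V4 → F
    B x y = x 0F * y 3F + x 3F * y 0F + σ * (x 1F * y 2F + x 2F * y 1F)

    IsSymplecticGFq : Mat → Set
    IsSymplecticGFq M = (∀ i j → InGFq (M i j)) × (∀ x y → B (M · x) (M · y) ≡ B x y)

    InC : V4 → Set
    InC x = (x 2F ≡ 0#) ×
            (x 0F * x 3F + x 1F * x 1F + σ * x 1F * x 2F + x 2F * x 2F ≡ 0#)

    Stabilizes : (V4 → V4) → Set
    Stabilizes f = ∀ x → NonZero x → (InC x ⇔ InC (f x))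

    gMat : F → F → F → F → Mat
    gMat a b c d = mkMat
      ( (a * a ∷ 0#    ∷ σ * a * b ∷ b * b ∷ [])
      ∷ (a * c ∷ 1#    ∷ σ * b * c ∷ b * d ∷ [])
      ∷ (0#    ∷ 0#    ∷ 1#        ∷ 0#    ∷ [])
      ∷ (c * c ∷ 0#    ∷ σ * c * d ∷ d * d ∷ [])
      ∷ [])

    GParams : F → F → F → F → Set
    GParams a b c d = InGFq a × InGFq b × InGFq c × InGFq d × (a * d + b * c ≡ 1#)

    tMat : F → Mat
    tMat v = mkMat
      ( (1# ∷ 0# ∷ 0# ∷ 0# ∷ [])
      ∷ (0# ∷ 1# ∷ v  ∷ 0# ∷ [])
      ∷ (0# ∷ 0# ∷ 1# ∷ 0# ∷ [])
      ∷ (0# ∷ 0# ∷ 0# ∷ 1# ∷ [])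
      ∷ [])

    gtτ : F → F → F → F → F → Bool → V4 → V4
    gtτ a b c d v e x = gMat a b c d · (tMat v · frob e x)

-- Counting shows that GF(q²) has characteristic two and that q is a power of two, so
-- x ↦ x^q is an injective ring endomorphism fixing exactly GF(q), x ↦ x^(q/2) extracts
-- square roots in GF(q), and there is some w ∉ GF(q).  The matrices of G and T preserve
-- B, commute with each other and with τ, and map the conic to itself, by computation.
--
-- Conversely, let M be symplectic over GF(q) with M τ^e stabilising C, and let u, v, z be
-- the columns 0, 1, 3 of M.  The conic contains the points (1, s, 0, s²) and (0, 0, 0, 1),
-- so Q(u + s v + s² z) = 0 for s = 0, 1, w^(q^e), w^(q^e) + 1, and Q z = 0.  As B is the
-- polar form of Q, this quartic in s has coefficients Q u, B(u,v), B(u,z) + Q v, B(v,z),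
-- Q z, all of which vanish.  Together with B(u, z) = 1 this forces v = (0, 1, 0, 0),
-- u = (a², ac, 0, c²), z = (b², bd, 0, d²) with ad + bc = 1 (square roots in GF(q)), and
-- orthogonality to u, z then pins down column 2 up to the parameter of T.  Uniqueness of
-- g t τ^e follows by comparing the images of a few points of PG(3, q), and of (1, w, 0, 0).
{-# OPTIONS --safe #-}
module Submission where

open import Defs
open import Level using (0ℓ)
open import Data.Nat as ℕ using (ℕ; zero; suc; _≤_; z≤n; s≤s)
import Data.Nat.Properties as ℕ
open import Data.Nat.Divisibility
  using (_∣_; _∣?_; divides; ∣m+n∣m⇒∣n; ∣1⇒≡1; *-cancelʳ-∣; m∣m*n; ∣m⇒∣m*n)
open import Data.Nat.Coprimality using (Coprime; coprime-divisor)
open import Data.Nat.Primality using (irreducible[2])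
open import Data.Nat.Tactic.RingSolver using (solve-∀)
open import Data.Fin as Fin using (Fin)
import Data.Fin.Properties as Fin
open import Data.Fin.Patterns using (0F; 1F; 2F; 3F)
open import Data.Fin.Permutation using (permutation)
open import Data.Vec using (Vec; []; _∷_; lookup)
open import Data.Vec.Relation.Unary.All using (All; []; _∷_)
open import Data.Vec.Relation.Unary.All.Properties using (lookup⁺)
open import Data.Bool using (Bool; true; false; _xor_; _∧_)
open import Data.Maybe using (Maybe; just; nothing)
open import Data.Sum using (_⊎_; inj₁; inj₂; [_,_]′)
open import Data.Product using (Σ; ∃-syntax; _×_; _,_; proj₁; proj₂)
open import Function using (_∘_)
open import Function.Definitions using (Injective)
open import Function.Bundles using (_↔_; Inverse; _⇔_; mk⇔; Equivalence)
open import Function.Construct.Composition using (_⇔-∘_)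
open import Function.Construct.Identity using (⇔-id)
open import Function.Construct.Symmetry using (⇔-sym)
open import Relation.Nullary using (¬_; Dec; yes; no; does; contradiction; _⊎-dec_; ¬?)
open import Relation.Nullary.Decidable using (dec-true; dec-false; map′; decidable-stable)
open import Relation.Binary.Definitions using (DecidableEquality; tri<; tri≈; tri>)
open import Relation.Binary.PropositionalEquality
open import Algebra.Bundles using (CommutativeRing; RawRing; AbelianGroup)
open import Algebra.Structures using (IsCommutativeRing)
import Algebra.Properties.Ring as RingProperties
import Algebra.Properties.Group as GroupProperties
import Algebra.Properties.CommutativeSemiring.Exp as Exp
open import Algebra.Solver.Ring.AlmostCommutativeRing using (fromCommutativeRing; _-Raw-AlmostCommutative⟶_)
import Algebra.Solver.Ring as RingSolver
open import Algebra.Properties.CommutativeMonoid.Sum ℕ.+-0-commutativeMonoid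
  using (sum; sum-permute; ∑-distrib-+; sum-cong-≗)

odd⇒coprime-2 : ∀ {m} → ¬ 2 ∣ m → Coprime m 2
odd⇒coprime-2 2∤m (d∣m , d∣2) with irreducible[2] d∣2
... | inj₁ d≡1 = d≡1
... | inj₂ refl = contradiction d∣m 2∤m

∣2^⇒≡2^ : ∀ k {m} → m ∣ 2 ℕ.^ k → ∃[ j ] m ≡ 2 ℕ.^ j
∣2^⇒≡2^ zero m∣1 = 0 , ∣1⇒≡1 m∣1
∣2^⇒≡2^ (suc k) {m} m∣2^1+k with 2 ∣? m
... | no 2∤m = ∣2^⇒≡2^ k (coprime-divisor (odd⇒coprime-2 2∤m) m∣2^1+k)
... | yes (divides m′ refl)
    with ∣2^⇒≡2^ k {m′} (*-cancelʳ-∣ 2 (subst (m′ ℕ.* 2 ∣_) (ℕ.*-comm 2 (2 ℕ.^ k)) m∣2^1+k))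
...   | j , refl = suc j , ℕ.*-comm (2 ℕ.^ j) 2

*-self≡2^⇒≡2^ : ∀ {q k} → q ℕ.* q ≡ 2 ℕ.^ k → ∃[ j ] q ≡ 2 ℕ.^ j
*-self≡2^⇒≡2^ {q} {k} q²≡2^k = ∣2^⇒≡2^ k (subst (q ∣_) q²≡2^k (m∣m*n q))

even-*-self≡2^ : ∀ {q} → 2 ∣ q → ∃[ k ] q ℕ.* q ≡ 2 ℕ.^ k → ∃[ j ] q ≡ 2 ℕ.^ suc j
even-*-self≡2^ {q} 2∣q (k , q²≡2^k) with *-self≡2^⇒≡2^ {q} {k} q²≡2^k
... | zero , refl = contradiction (∣1⇒≡1 2∣q) λ ()
... | suc j , q≡2^1+j = j , q≡2^1+j

indicator : Bool → ℕ
indicator true = 1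
indicator false = 0

sum-const-0 : ∀ m → sum {m} (λ _ → 0) ≡ 0
sum-const-0 zero = refl
sum-const-0 (suc m) = sum-const-0 m

sum-const-1 : ∀ m → sum {m} (λ _ → 1) ≡ m
sum-const-1 zero = refl
sum-const-1 (suc m) = cong suc (sum-const-1 m)

sum-indicator-≟ : ∀ {m} (c : Fin m) → sum (λ i → indicator (does (i Fin.≟ c))) ≡ 1
sum-indicator-≟ {suc m} Fin.zero = cong suc (sum-const-0 m)
sum-indicator-≟ (Fin.suc c) = sum-indicator-≟ c

module _ {a b} {A : Set a} {B : Set b} where

  indicator-⊎-absorbʳ : (a? : Dec A) (b? : Dec B) → (B → A) →
                        indicator (does (a? ⊎-dec b?)) ≡ indicator (does a?)
  indicator-⊎-absorbʳ (yes _) _ _ = refl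
  indicator-⊎-absorbʳ (no _) (no _) _ = refl
  indicator-⊎-absorbʳ (no ¬a) (yes b) b⇒a = contradiction (b⇒a b) ¬a

  indicator-⊎-disjoint : (a? : Dec A) (b? : Dec B) → (A → ¬ B) →
                         indicator (does (a? ⊎-dec b?)) ≡ indicator (does a?) ℕ.+ indicator (does b?)
  indicator-⊎-disjoint (yes a) (yes b) a⇒¬b = contradiction b (a⇒¬b a)
  indicator-⊎-disjoint (yes _) (no _) _ = refl
  indicator-⊎-disjoint (no _) _ _ = refl

module _ {n} (π : Fin n → Fin n) (π-involutive : ∀ i → π (π i) ≡ i) where

  private
    ascent descent fixed : Fin n → ℕ
    ascent i = indicator (does (i Fin.<? π i))
    descent i = indicator (does (π i Fin.<? i))
    fixed i = indicator (does (i Fin.≟ π i))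

    trichotomy : ∀ i → ascent i ℕ.+ fixed i ℕ.+ descent i ≡ 1
    trichotomy i with Fin.<-cmp i (π i)
    ... | tri< i<πi i≢πi πi≮i rewrite dec-true (i Fin.<? π i) i<πi
                                    | dec-false (i Fin.≟ π i) i≢πi
                                    | dec-false (π i Fin.<? i) πi≮i = refl
    ... | tri≈ i≮πi i≡πi πi≮i rewrite dec-false (i Fin.<? π i) i≮πi
                                    | dec-true (i Fin.≟ π i) i≡πi
                                    | dec-false (π i Fin.<? i) πi≮i = refl
    ... | tri> i≮πi i≢πi πi<i rewrite dec-false (i Fin.<? π i) i≮πi
                                    | dec-false (i Fin.≟ π i) i≢πi
                                    | dec-true (π i Fin.<? i) πi<i = refl

  -- Pair each ascent i < π i with the descent at π i.
  involution-size : n ≡ 2 ℕ.* sum ascent ℕ.+ sum fixed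
  involution-size = begin
    n                                                ≡⟨ sum-const-1 n ⟨
    sum {n} (λ _ → 1)                                ≡⟨ sum-cong-≗ (λ i → sym (trichotomy i)) ⟩
    sum (λ i → ascent i ℕ.+ fixed i ℕ.+ descent i)   ≡⟨ ∑-distrib-+ _ descent ⟩
    sum (λ i → ascent i ℕ.+ fixed i) ℕ.+ sum descent ≡⟨ cong₂ ℕ._+_ (∑-distrib-+ ascent fixed) descents≡ascents ⟩
    sum ascent ℕ.+ sum fixed ℕ.+ sum ascent          ≡⟨ rearrange (sum ascent) (sum fixed) ⟩
    2 ℕ.* sum ascent ℕ.+ sum fixed                   ∎
    where
    open ≡-Reasoning
    descents≡ascents : sum descent ≡ sum ascent
    descents≡ascents = begin
      sum descent                ≡⟨ sum-cong-≗ (λ i → cong (λ j → indicator (does (π i Fin.<? j))) (sym (π-involutive i))) ⟩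
      sum (λ i → ascent (π i))   ≡⟨ sum-permute ascent (permutation π π π-involutive π-involutive) ⟨
      sum ascent                 ∎
    rearrange : ∀ a f → a ℕ.+ f ℕ.+ a ≡ 2 ℕ.* a ℕ.+ f
    rearrange = solve-∀

  involution-with-one-fixed-point⇒odd : (c : Fin n) → c ≡ π c → (∀ i → i ≡ π i → i ≡ c) → ¬ 2 ∣ n
  involution-with-one-fixed-point⇒odd c c-fixed only-c 2∣n =
    contradiction (∣1⇒≡1 (∣m+n∣m⇒∣n (subst (2 ∣_) n≡2a+1 2∣n) (m∣m*n (sum ascent)))) λ ()
    where
    fixed≗[≟c] : ∀ i → fixed i ≡ indicator (does (i Fin.≟ c))
    fixed≗[≟c] i with i Fin.≟ π i | i Fin.≟ c
    ... | yes _ | yes _ = refl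
    ... | no _ | no _ = refl
    ... | yes i≡πi | no i≢c = contradiction (only-c i i≡πi) i≢c
    ... | no i≢πi | yes refl = contradiction c-fixed i≢πi
    n≡2a+1 : n ≡ 2 ℕ.* sum ascent ℕ.+ 1
    n≡2a+1 = trans involution-size (cong (2 ℕ.* sum ascent ℕ.+_) (trans (sum-cong-≗ fixed≗[≟c]) (sum-indicator-≟ c)))

module FieldProperties (K : Field) where
  open Field K renaming (Carrier to F)
  open IsCommutativeRing isCommutativeRing
    using (*-comm; *-assoc; *-identityˡ; zeroˡ; zeroʳ; +-identityʳ)

  commutativeRing : CommutativeRing 0ℓ 0ℓ
  commutativeRing = record { isCommutativeRing = isCommutativeRing }

  nonzero-*-cancel : ∀ {x y} → x ≢ 0# → x * y ≡ 0# → y ≡ 0#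
  nonzero-*-cancel {x} {y} x≢0 xy≡0 with inverse x x≢0
  ... | x⁻¹ , xx⁻¹≡1 = begin
    y               ≡⟨ sym (*-identityˡ y) ⟩
    1# * y          ≡⟨ cong (_* y) (trans (sym xx⁻¹≡1) (*-comm x x⁻¹)) ⟩
    (x⁻¹ * x) * y   ≡⟨ *-assoc x⁻¹ x y ⟩
    x⁻¹ * (x * y)   ≡⟨ cong (x⁻¹ *_) xy≡0 ⟩
    x⁻¹ * 0#        ≡⟨ zeroʳ x⁻¹ ⟩
    0#              ∎
    where open ≡-Reasoning

  1≢0 : 1# ≢ 0#
  1≢0 1≡0 = 0≢1 (sym 1≡0)

  x+0*y≡x : ∀ x y → x + 0# * y ≡ x
  x+0*y≡x x y = trans (cong (x +_) (zeroˡ y)) (+-identityʳ x)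

  x+y*0≡x : ∀ x y → x + y * 0# ≡ x
  x+y*0≡x x y = trans (cong (x +_) (zeroʳ y)) (+-identityʳ x)

  module WithDecidableEquality (_≟_ : DecidableEquality F) where

    zero-product : ∀ {x y} → x * y ≡ 0# → x ≡ 0# ⊎ y ≡ 0#
    zero-product {x} xy≡0 with x ≟ 0#
    ... | yes x≡0 = inj₁ x≡0
    ... | no x≢0 = inj₂ (nonzero-*-cancel x≢0 xy≡0)

module CharTwo (K : Field) (char2 : Field._+_ K (Field.1# K) (Field.1# K) ≡ Field.0# K) where
  open Field K renaming (Carrier to F)
  open IsCommutativeRing isCommutativeRing
    using (+-assoc; +-identityˡ; +-identityʳ; *-identityˡ; zeroˡ; zeroʳ; -‿inverseˡ; distribˡ; *-comm)
  open FieldProperties K using (commutativeRing; nonzero-*-cancel)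

  -- The prime field GF(2) = Bool (with xor, ∧) maps into K, so the ring solver
  -- may use coefficients that are computed modulo 2.
  private
    GF2 : RawRing 0ℓ 0ℓ
    GF2 = record { Carrier = Bool ; _≈_ = _≡_ ; _+_ = _xor_ ; _*_ = _∧_ ; -_ = λ b → b ; 0# = false ; 1# = true }

    ⟦_⟧₂ : Bool → F
    ⟦ true ⟧₂ = 1#
    ⟦ false ⟧₂ = 0#

    -‿self : ∀ b → - ⟦ b ⟧₂ ≡ ⟦ b ⟧₂
    -‿self b = begin
      - ⟦ b ⟧₂                         ≡⟨ sym (+-identityʳ _) ⟩
      - ⟦ b ⟧₂ + 0#                    ≡⟨ cong (- ⟦ b ⟧₂ +_) (sym (b+b≡0 b)) ⟩
      - ⟦ b ⟧₂ + (⟦ b ⟧₂ + ⟦ b ⟧₂)     ≡⟨ sym (+-assoc _ _ _) ⟩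
      (- ⟦ b ⟧₂ + ⟦ b ⟧₂) + ⟦ b ⟧₂     ≡⟨ cong (_+ ⟦ b ⟧₂) (-‿inverseˡ _) ⟩
      0# + ⟦ b ⟧₂                      ≡⟨ +-identityˡ _ ⟩
      ⟦ b ⟧₂                           ∎
      where
      open ≡-Reasoning
      b+b≡0 : ∀ b → ⟦ b ⟧₂ + ⟦ b ⟧₂ ≡ 0#
      b+b≡0 true = char2
      b+b≡0 false = +-identityˡ 0#

    GF2→K : GF2 -Raw-AlmostCommutative⟶ fromCommutativeRing commutativeRing
    GF2→K = record
      { ⟦_⟧ = ⟦_⟧₂
      ; +-homo = λ { true true → sym char2 ; true false → sym (+-identityʳ 1#)
                   ; false true → sym (+-identityˡ 1#) ; false false → sym (+-identityˡ 0#) }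
      ; *-homo = λ { true true → sym (*-identityˡ 1#) ; true false → sym (zeroʳ 1#)
                   ; false true → sym (zeroˡ 1#) ; false false → sym (zeroˡ 0#) }
      ; -‿homo = λ b → sym (-‿self b)
      ; 0-homo = refl
      ; 1-homo = refl
      }

    _≟₂_ : ∀ a b → Maybe (⟦ a ⟧₂ ≡ ⟦ b ⟧₂)
    true ≟₂ true = just refl
    false ≟₂ false = just refl
    _ ≟₂ _ = nothing

  open RingSolver GF2 (fromCommutativeRing commutativeRing) GF2→K _≟₂_ public
    using (solve; _:=_; _:+_; _:*_; con; Polynomial)

  0ₚ 1ₚ : ∀ {n} → Polynomial n
  0ₚ = con false
  1ₚ = con true

  x+x≡0 : ∀ x → x + x ≡ 0#
  x+x≡0 = solve 1 (λ x → x :+ x := 0ₚ) refl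

  x+y+y≡x : ∀ x y → x + y + y ≡ x
  x+y+y≡x = solve 2 (λ x y → x :+ y :+ y := x) refl

  x+⟨x+y⟩≡y : ∀ x y → x + (x + y) ≡ y
  x+⟨x+y⟩≡y = solve 2 (λ x y → x :+ (x :+ y) := y) refl

  x+y+z≡x+z+y : ∀ x y z → x + y + z ≡ x + z + y
  x+y+z≡x+z+y = solve 3 (λ x y z → x :+ y :+ z := x :+ z :+ y) refl

  x+y+⟨z+y⟩≡x+z : ∀ x y z → x + y + (z + y) ≡ x + z
  x+y+⟨z+y⟩≡x+z = solve 3 (λ x y z → x :+ y :+ (z :+ y) := x :+ z) refl

  x+y≡0⇒x≡y : ∀ {x y} → x + y ≡ 0# → x ≡ y
  x+y≡0⇒x≡y {x} {y} x+y≡0 = trans (sym (x+y+y≡x x y)) (trans (cong (_+ y) x+y≡0) (+-identityˡ y))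

  x≡y⇒x+y≡0 : ∀ {x y} → x ≡ y → x + y ≡ 0#
  x≡y⇒x+y≡0 {x} refl = x+x≡0 x

  square-* : ∀ x y → (x * y) * (x * y) ≡ (x * x) * (y * y)
  square-* = solve 2 (λ x y → (x :* y) :* (x :* y) := (x :* x) :* (y :* y)) refl

  square-+ : ∀ x y → (x + y) * (x + y) ≡ x * x + y * y
  square-+ = solve 2 (λ x y → (x :+ y) :* (x :+ y) := x :* x :+ y :* y) refl

  three-roots⇒zero : ∀ {c₁ c₂ c₃ w} → w ≢ 0# → w + 1# ≢ 0# →
    c₁ + 1# * (c₂ + 1# * c₃) ≡ 0# → c₁ + w * (c₂ + w * c₃) ≡ 0# → c₁ + (w + 1#) * (c₂ + (w + 1#) * c₃) ≡ 0# →
    c₁ ≡ 0# × c₂ ≡ 0# × c₃ ≡ 0#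
  three-roots⇒zero {c₁} {c₂} {c₃} {w} w≢0 w+1≢0 p[1]≡0 p[w]≡0 p[w+1]≡0 =
    c₁≡0 , trans (x+y≡0⇒x≡y c₂+c₃≡0) c₃≡0 , c₃≡0
    where
    open ≡-Reasoning
    p : F → F
    p s = c₁ + s * (c₂ + s * c₃)
    c₂+c₃≡0 : c₂ + c₃ ≡ 0#
    c₂+c₃≡0 = begin
      c₂ + c₃            ≡⟨ solve 4 (λ c₁ c₂ c₃ w → let p s = c₁ :+ s :* (c₂ :+ s :* c₃) in
                              c₂ :+ c₃ := p w :+ p (w :+ 1ₚ)) refl c₁ c₂ c₃ w ⟩
      p w + p (w + 1#)   ≡⟨ cong₂ _+_ p[w]≡0 p[w+1]≡0 ⟩
      0# + 0#            ≡⟨ +-identityˡ 0# ⟩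
      0#                 ∎
    c₁≡0 : c₁ ≡ 0#
    c₁≡0 = begin
      c₁                 ≡⟨ +-identityʳ c₁ ⟨
      c₁ + 0#            ≡⟨ cong (c₁ +_) c₂+c₃≡0 ⟨
      c₁ + (c₂ + c₃)     ≡⟨ solve 3 (λ c₁ c₂ c₃ → c₁ :+ (c₂ :+ c₃) := c₁ :+ 1ₚ :* (c₂ :+ 1ₚ :* c₃)) refl c₁ c₂ c₃ ⟩
      p 1#               ≡⟨ p[1]≡0 ⟩
      0#                 ∎
    c₃≡0 : c₃ ≡ 0#
    c₃≡0 = nonzero-*-cancel w+1≢0 (nonzero-*-cancel w≢0 (begin
      w * ((w + 1#) * c₃)          ≡⟨ solve 4 (λ c₁ c₂ c₃ w → w :* ((w :+ 1ₚ) :* c₃) :=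
                                        c₁ :+ w :* (c₂ :+ w :* c₃) :+ c₁ :+ w :* (c₂ :+ c₃)) refl c₁ c₂ c₃ w ⟩
      p w + c₁ + w * (c₂ + c₃)     ≡⟨ cong₂ (λ x y → x + c₁ + w * y) p[w]≡0 c₂+c₃≡0 ⟩
      0# + c₁ + w * 0#             ≡⟨ cong₂ (λ x y → 0# + x + y) c₁≡0 (zeroʳ w) ⟩
      0# + 0# + 0#                 ≡⟨ solve 0 (0ₚ :+ 0ₚ :+ 0ₚ := 0ₚ) refl ⟩
      0#                           ∎))

  -- Polynomials are coefficient vectors, constant term first.
  eval : ∀ {d} → Vec F (suc d) → F → F
  eval {zero} (c ∷ []) x = c
  eval {suc d} (c ∷ cs) x = c + x * eval cs x

  leading : ∀ {d} → Vec F (suc d) → F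
  leading {zero} (c ∷ []) = c
  leading {suc d} (c ∷ cs) = leading cs

  quotient : ∀ {d} → Vec F (suc (suc d)) → F → Vec F (suc d)
  quotient {zero} (c ∷ cs) r = cs
  quotient {suc d} (c ∷ cs) r = eval cs r ∷ quotient cs r

  eval-quotient : ∀ {d} (p : Vec F (suc (suc d))) r x → eval p x ≡ eval p r + (x + r) * eval (quotient p r) x
  eval-quotient {zero} (c ∷ c′ ∷ []) r x =
    solve 4 (λ c c′ r x → c :+ x :* c′ := c :+ r :* c′ :+ (x :+ r) :* c′) refl c c′ r x
  eval-quotient {suc d} (c ∷ cs) r x = begin
    c + x * eval cs x                                                        ≡⟨ cong (λ y → c + x * y) (eval-quotient cs r x) ⟩
    c + x * (eval cs r + (x + r) * eval (quotient cs r) x)                   ≡⟨ step c x r _ _ ⟩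
    c + r * eval cs r + (x + r) * (eval cs r + x * eval (quotient cs r) x)   ∎
    where
    open ≡-Reasoning
    step : ∀ c x r e q → c + x * (e + (x + r) * q) ≡ c + r * e + (x + r) * (e + x * q)
    step = solve 5 (λ c x r e q → c :+ x :* (e :+ (x :+ r) :* q) := c :+ r :* e :+ (x :+ r) :* (e :+ x :* q)) refl

  leading-quotient : ∀ {d} (p : Vec F (suc (suc d))) r → leading (quotient p r) ≡ leading p
  leading-quotient {zero} (c ∷ c′ ∷ []) r = refl
  leading-quotient {suc d} (c ∷ cs) r = leading-quotient cs r

  no-more-roots-than-degree : ∀ d (p : Vec F (suc d)) → leading p ≢ 0# →
                              (r : Fin (suc d) → F) → Injective _≡_ _≡_ r → ¬ (∀ i → eval p (r i) ≡ 0#)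
  no-more-roots-than-degree zero (c ∷ []) c≢0 r r-injective roots = c≢0 (roots Fin.zero)
  no-more-roots-than-degree (suc d) p p≢0 r r-injective roots =
    no-more-roots-than-degree d (quotient p (r Fin.zero)) (p≢0 ∘ trans (sym (leading-quotient p _)))
      (r ∘ Fin.suc) (Fin.suc-injective ∘ r-injective) quotient-roots
    where
    r₀ : F
    r₀ = r Fin.zero
    quotient-roots : ∀ i → eval (quotient p r₀) (r (Fin.suc i)) ≡ 0#
    quotient-roots i = nonzero-*-cancel (λ rᵢ+r₀≡0 → Fin.0≢1+n (r-injective (sym (x+y≡0⇒x≡y rᵢ+r₀≡0)))) (begin
      (rᵢ + r₀) * q rᵢ               ≡⟨ +-identityˡ _ ⟨
      0# + (rᵢ + r₀) * q rᵢ          ≡⟨ cong (λ z → z + (rᵢ + r₀) * q rᵢ) (roots Fin.zero) ⟨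
      eval p r₀ + (rᵢ + r₀) * q rᵢ   ≡⟨ eval-quotient p r₀ rᵢ ⟨
      eval p rᵢ                      ≡⟨ roots (Fin.suc i) ⟩
      0#                             ∎)
      where
      open ≡-Reasoning
      rᵢ : F
      rᵢ = r (Fin.suc i)
      q : F → F
      q = eval (quotient p r₀)

  module WithDecidableEquality (_≟_ : DecidableEquality F) where
    open FieldProperties.WithDecidableEquality K _≟_

    square-≢0 : ∀ {x} → x ≢ 0# → x * x ≢ 0#
    square-≢0 x≢0 x²≡0 = [ x≢0 , x≢0 ]′ (zero-product x²≡0)

    *-cancelʳ-nonzero : ∀ {z l m} → z ≢ 0# → l * z ≡ m * z → l ≡ m
    *-cancelʳ-nonzero {z} {l} {m} z≢0 lz≡mz = x+y≡0⇒x≡y (nonzero-*-cancel z≢0 (begin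
      z * (l + m)     ≡⟨ distribˡ z l m ⟩
      z * l + z * m   ≡⟨ cong₂ _+_ (*-comm z l) (*-comm z m) ⟩
      l * z + m * z   ≡⟨ x≡y⇒x+y≡0 lz≡mz ⟩
      0#              ∎))
      where open ≡-Reasoning

    square-injective : ∀ {x y} → x * x ≡ y * y → x ≡ y
    square-injective {x} {y} x²≡y² with zero-product (trans (square-+ x y) (x≡y⇒x+y≡0 x²≡y²))
    ... | inj₁ x+y≡0 = x+y≡0⇒x≡y x+y≡0
    ... | inj₂ x+y≡0 = x+y≡0⇒x≡y x+y≡0

module Enumerated (K : Field) {n} (enumeration : Fin n ↔ Field.Carrier K) where
  open Field K renaming (Carrier to F)
  open IsCommutativeRing isCommutativeRing using (+-assoc; +-identityˡ; *-identityˡ; distribʳ; -‿inverseʳ)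
  open FieldProperties K using (commutativeRing; nonzero-*-cancel)
  open RingProperties (CommutativeRing.ring commutativeRing) using (-‿involutive; -0#≈0#)
  open Inverse enumeration public using () renaming (to to element; from to index)

  element-index : ∀ x → element (index x) ≡ x
  element-index = Inverse.strictlyInverseˡ enumeration

  index-element : ∀ i → index (element i) ≡ i
  index-element = Inverse.strictlyInverseʳ enumeration

  index-injective : ∀ {x y} → index x ≡ index y → x ≡ y
  index-injective {x} {y} i≡j = trans (sym (element-index x)) (trans (cong element i≡j) (element-index y))

  element-injective : ∀ {i j} → element i ≡ element j → i ≡ j
  element-injective {i} {j} eq = trans (sym (index-element i)) (trans (cong index eq) (index-element j))

  _≟_ : DecidableEquality F
  x ≟ y = map′ index-injective (cong index) (index x Fin.≟ index y)

  module _ (f : F → F) (f-involutive : ∀ x → f (f x) ≡ x) where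

    reindexed : Fin n → Fin n
    reindexed = index ∘ f ∘ element

    reindexed-involutive : ∀ i → reindexed (reindexed i) ≡ i
    reindexed-involutive i = begin
      index (f (element (index (f (element i))))) ≡⟨ cong (index ∘ f) (element-index _) ⟩
      index (f (f (element i)))                   ≡⟨ cong index (f-involutive _) ⟩
      index (element i)                           ≡⟨ index-element i ⟩
      i                                           ∎
      where open ≡-Reasoning

    sum-involution-invariant : (g : F → ℕ) → sum (g ∘ element) ≡ sum (g ∘ f ∘ element)
    sum-involution-invariant g = begin
      sum (g ∘ element)                    ≡⟨ sum-permute _ (permutation reindexed reindexed reindexed-involutive reindexed-involutive) ⟩
      sum (g ∘ element ∘ reindexed)        ≡⟨ sum-cong-≗ (cong g ∘ element-index ∘ f ∘ element) ⟩
      sum (g ∘ f ∘ element)                ∎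
      where open ≡-Reasoning

  -- Outside characteristic two, negation is an involution of F fixing only 0.
  even-size⇒char2 : 2 ∣ n → 1# + 1# ≡ 0#
  even-size⇒char2 2∣n with (1# + 1#) ≟ 0#
  ... | yes 2≡0 = 2≡0
  ... | no 2≢0 = contradiction 2∣n
    (involution-with-one-fixed-point⇒odd negate (reindexed-involutive -_ -‿involutive)
      (index 0#) zero-fixed only-zero-fixed)
    where
    negate : Fin n → Fin n
    negate = reindexed -_ -‿involutive
    self-negative⇒zero : ∀ x → x ≡ - x → x ≡ 0#
    self-negative⇒zero x x≡-x = nonzero-*-cancel 2≢0 (begin
      (1# + 1#) * x   ≡⟨ distribʳ x 1# 1# ⟩
      1# * x + 1# * x ≡⟨ cong₂ _+_ (*-identityˡ x) (trans (*-identityˡ x) x≡-x) ⟩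
      x + - x         ≡⟨ -‿inverseʳ x ⟩
      0#              ∎)
      where open ≡-Reasoning
    zero-fixed : index 0# ≡ negate (index 0#)
    zero-fixed = cong index (sym (trans (cong -_ (element-index 0#)) -0#≈0#))
    only-zero-fixed : ∀ i → i ≡ negate i → i ≡ index 0#
    only-zero-fixed i i≡-i = trans (sym (index-element i)) (cong index (self-negative⇒zero (element i)
      (trans (cong element i≡-i) (element-index _))))

  sum-indicator-≡ : ∀ c → sum (λ i → indicator (does (element i ≟ c))) ≡ 1
  sum-indicator-≡ c = trans (sum-cong-≗ λ i → cong indicator (does-≡ i)) (sum-indicator-≟ (index c))
    where
    does-≡ : ∀ i → does (element i ≟ c) ≡ does (i Fin.≟ index c)
    does-≡ i = cong (λ j → does (j Fin.≟ index c)) (index-element i)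

  module _ (char2 : 1# + 1# ≡ 0#) where
    open CharTwo K char2

    -- x lies in the span of g over the prime field GF(2)
    InSpan : ∀ {m} → (Fin m → F) → F → Set
    InSpan {zero} g x = x ≡ 0#
    InSpan {suc m} g x = InSpan (g ∘ Fin.suc) x ⊎ InSpan (g ∘ Fin.suc) (x + g Fin.zero)

    inSpan? : ∀ {m} (g : Fin m → F) x → Dec (InSpan g x)
    inSpan? {zero} g x = x ≟ 0#
    inSpan? {suc m} g x = inSpan? (g ∘ Fin.suc) x ⊎-dec inSpan? (g ∘ Fin.suc) (x + g Fin.zero)

    InSpan-0 : ∀ {m} (g : Fin m → F) → InSpan g 0#
    InSpan-0 {zero} g = refl
    InSpan-0 {suc m} g = inj₁ (InSpan-0 _)

    InSpan-+ : ∀ {m} (g : Fin m → F) {x y} → InSpan g x → InSpan g y → InSpan g (x + y)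
    InSpan-+ {zero} g refl refl = +-identityˡ 0#
    InSpan-+ {suc m} g {x} {y} (inj₁ x∈) (inj₁ y∈) = inj₁ (InSpan-+ _ x∈ y∈)
    InSpan-+ {suc m} g {x} {y} (inj₁ x∈) (inj₂ y+g∈) =
      inj₂ (subst (InSpan _) (sym (+-assoc x y _)) (InSpan-+ _ x∈ y+g∈))
    InSpan-+ {suc m} g {x} {y} (inj₂ x+g∈) (inj₁ y∈) =
      inj₂ (subst (InSpan _) (x+y+z≡x+z+y x _ y) (InSpan-+ _ x+g∈ y∈))
    InSpan-+ {suc m} g {x} {y} (inj₂ x+g∈) (inj₂ y+g∈) =
      inj₁ (subst (InSpan _) (x+y+⟨z+y⟩≡x+z x _ y) (InSpan-+ _ x+g∈ y+g∈))

    InSpan-generator : ∀ {m} (g : Fin m → F) i → InSpan g (g i)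
    InSpan-generator {suc m} g Fin.zero = inj₂ (subst (InSpan _) (sym (x+x≡0 _)) (InSpan-0 _))
    InSpan-generator {suc m} g (Fin.suc i) = inj₁ (InSpan-generator _ i)

    counted : ∀ {m} → (Fin m → F) → F → ℕ
    counted g x = indicator (does (inSpan? g x))

    spanSize : ∀ {m} → (Fin m → F) → ℕ
    spanSize g = sum (counted g ∘ element)

    module _ {m} (g : Fin (suc m) → F) where
      private
        h : Fin m → F
        h = g ∘ Fin.suc
        g₀ : F
        g₀ = g Fin.zero

      counted-absorb : InSpan h g₀ → ∀ x → counted g x ≡ counted h x
      counted-absorb g₀∈ x = indicator-⊎-absorbʳ (inSpan? h x) (inSpan? h (x + g₀))
        (λ x+g₀∈ → subst (InSpan h) (x+y+y≡x x g₀) (InSpan-+ h x+g₀∈ g₀∈))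

      counted-split : ¬ InSpan h g₀ → ∀ x → counted g x ≡ counted h x ℕ.+ counted h (x + g₀)
      counted-split g₀∉ x = indicator-⊎-disjoint (inSpan? h x) (inSpan? h (x + g₀))
        (λ x∈ x+g₀∈ → g₀∉ (subst (InSpan h) (x+⟨x+y⟩≡y x g₀) (InSpan-+ h x∈ x+g₀∈)))

    -- Adjoining a generator either leaves the span unchanged or doubles it.
    spanSize≡2^ : ∀ {m} (g : Fin m → F) → ∃[ k ] spanSize g ≡ 2 ℕ.^ k
    spanSize≡2^ {zero} g = 0 , sum-indicator-≡ 0#
    spanSize≡2^ {suc m} g with spanSize≡2^ (g ∘ Fin.suc) | inSpan? (g ∘ Fin.suc) (g Fin.zero)
    ... | k , size≡2^k | yes g₀∈ = k , trans (sum-cong-≗ (counted-absorb g g₀∈ ∘ element)) size≡2^k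
    ... | k , size≡2^k | no g₀∉ = suc k , (begin
      spanSize g                                          ≡⟨ sum-cong-≗ (counted-split g g₀∉ ∘ element) ⟩
      sum {n} (λ i → counted h (element i) ℕ.+ translate i) ≡⟨ ∑-distrib-+ (counted h ∘ element) translate ⟩
      spanSize h ℕ.+ sum translate
        ≡⟨ cong (spanSize h ℕ.+_) (sum-involution-invariant (_+ g₀) (λ x → x+y+y≡x x g₀) (counted h)) ⟨
      spanSize h ℕ.+ spanSize h                           ≡⟨ cong₂ ℕ._+_ size≡2^k (trans size≡2^k (sym (ℕ.+-identityʳ _))) ⟩
      2 ℕ.^ suc k                                         ∎)
      where
      open ≡-Reasoning
      h : Fin m → F
      h = g ∘ Fin.suc
      g₀ : F
      g₀ = g Fin.zero
      translate : Fin n → ℕ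
      translate i = counted h (element i + g₀)

    char2⇒size≡2^ : ∃[ k ] n ≡ 2 ℕ.^ k
    char2⇒size≡2^ = let (k , size≡2^k) = spanSize≡2^ element in k , (begin
      n                   ≡⟨ sum-const-1 n ⟨
      sum {n} (λ _ → 1)   ≡⟨ sum-cong-≗ (λ i → cong indicator (dec-true (inSpan? element _) (InSpan-generator element i))) ⟨
      spanSize element    ≡⟨ size≡2^k ⟩
      2 ℕ.^ k             ∎)
      where open ≡-Reasoning

module PowerLaws (K : Field) (q : ℕ) where
  open Field K renaming (Carrier to F)
  open IsCommutativeRing isCommutativeRing using (*-identityˡ)
  open FieldProperties K using (commutativeRing; 1≢0)
  open Geometry K q using (_^_)
  open Exp (CommutativeRing.commutativeSemiring commutativeRing)
    using (^-homo-*; ^-assocʳ; ^-distrib-*) renaming (_^_ to _^ᴸ_)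

  ^≡^ᴸ : ∀ x n → x ^ n ≡ x ^ᴸ n
  ^≡^ᴸ x zero = refl
  ^≡^ᴸ x (suc n) = cong (x *_) (^≡^ᴸ x n)

  ^-+ : ∀ x m n → x ^ (m ℕ.+ n) ≡ x ^ m * x ^ n
  ^-+ x m n = begin
    x ^ (m ℕ.+ n)        ≡⟨ ^≡^ᴸ x (m ℕ.+ n) ⟩
    x ^ᴸ (m ℕ.+ n)       ≡⟨ ^-homo-* x m n ⟩
    x ^ᴸ m * x ^ᴸ n      ≡⟨ sym (cong₂ _*_ (^≡^ᴸ x m) (^≡^ᴸ x n)) ⟩
    x ^ m * x ^ n        ∎
    where open ≡-Reasoning

  ^-*-distrib : ∀ x y n → (x * y) ^ n ≡ x ^ n * y ^ n
  ^-*-distrib x y n = begin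
    (x * y) ^ n          ≡⟨ ^≡^ᴸ (x * y) n ⟩
    (x * y) ^ᴸ n         ≡⟨ ^-distrib-* x y n ⟩
    x ^ᴸ n * y ^ᴸ n      ≡⟨ sym (cong₂ _*_ (^≡^ᴸ x n) (^≡^ᴸ y n)) ⟩
    x ^ n * y ^ n        ∎
    where open ≡-Reasoning

  ^-^-comm : ∀ x m n → (x ^ m) ^ n ≡ (x ^ n) ^ m
  ^-^-comm x m n = begin
    (x ^ m) ^ n          ≡⟨ trans (^≡^ᴸ _ n) (cong (_^ᴸ n) (^≡^ᴸ x m)) ⟩
    (x ^ᴸ m) ^ᴸ n        ≡⟨ ^-assocʳ x m n ⟩
    x ^ᴸ (m ℕ.* n)       ≡⟨ cong (x ^ᴸ_) (ℕ.*-comm m n) ⟩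
    x ^ᴸ (n ℕ.* m)       ≡⟨ sym (^-assocʳ x n m) ⟩
    (x ^ᴸ n) ^ᴸ m        ≡⟨ sym (trans (^≡^ᴸ _ m) (cong (_^ᴸ m) (^≡^ᴸ x n))) ⟩
    (x ^ n) ^ m          ∎
    where open ≡-Reasoning

  1^ : ∀ n → 1# ^ n ≡ 1#
  1^ zero = refl
  1^ (suc n) = trans (*-identityˡ _) (1^ n)

  module WithDecidableEquality (_≟_ : DecidableEquality F) where
    open FieldProperties.WithDecidableEquality K _≟_

    ^≡0⇒≡0 : ∀ x n → x ^ n ≡ 0# → x ≡ 0#
    ^≡0⇒≡0 x zero 1≡0 = contradiction 1≡0 1≢0
    ^≡0⇒≡0 x (suc n) xⁿ⁺¹≡0 with zero-product xⁿ⁺¹≡0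
    ... | inj₁ x≡0 = x≡0
    ... | inj₂ xⁿ≡0 = ^≡0⇒≡0 x n xⁿ≡0

module Frobenius (K : Field) (char2 : Field._+_ K (Field.1# K) (Field.1# K) ≡ Field.0# K)
                 (_≟_ : DecidableEquality (Field.Carrier K))
                 (q j : ℕ) (q≡2^1+j : q ≡ 2 ℕ.^ suc j) where
  open Field K renaming (Carrier to F)
  open IsCommutativeRing isCommutativeRing using (*-identityʳ; zeroˡ; +-identityˡ; distribˡ)
  open FieldProperties K
  open CharTwo K char2
  open CharTwo.WithDecidableEquality K char2 _≟_
  open PowerLaws K q
  open PowerLaws.WithDecidableEquality K q _≟_
  open Geometry K q using (_^_; InGFq)

  2≤q : 2 ≤ q
  2≤q = subst (2 ≤_) (sym q≡2^1+j) (ℕ.^-monoʳ-≤ 2 {1} {suc j} (s≤s z≤n))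

  q≡2+ : q ≡ 2 ℕ.+ (q ℕ.∸ 2)
  q≡2+ = sym (ℕ.m+[n∸m]≡n 2≤q)

  +-^-2^ : ∀ x y k → (x + y) ^ (2 ℕ.^ k) ≡ x ^ (2 ℕ.^ k) + y ^ (2 ℕ.^ k)
  +-^-2^ x y zero = trans (*-identityʳ _) (sym (cong₂ _+_ (*-identityʳ x) (*-identityʳ y)))
  +-^-2^ x y (suc k) = begin
    (x + y) ^ (2 ℕ.^ suc k)                                  ≡⟨ square (x + y) k ⟩
    (x + y) ^ (2 ℕ.^ k) * (x + y) ^ (2 ℕ.^ k)                 ≡⟨ cong (λ z → z * z) (+-^-2^ x y k) ⟩
    (x ^ (2 ℕ.^ k) + y ^ (2 ℕ.^ k)) * (x ^ (2 ℕ.^ k) + y ^ (2 ℕ.^ k)) ≡⟨ square-+ _ _ ⟩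
    x ^ (2 ℕ.^ k) * x ^ (2 ℕ.^ k) + y ^ (2 ℕ.^ k) * y ^ (2 ℕ.^ k)   ≡⟨ sym (cong₂ _+_ (square x k) (square y k)) ⟩
    x ^ (2 ℕ.^ suc k) + y ^ (2 ℕ.^ suc k)                    ∎
    where
    open ≡-Reasoning
    square : ∀ z k → z ^ (2 ℕ.^ suc k) ≡ z ^ (2 ℕ.^ k) * z ^ (2 ℕ.^ k)
    square z k = trans (^-+ z (2 ℕ.^ k) _) (cong (λ n → z ^ (2 ℕ.^ k) * z ^ n) (ℕ.+-identityʳ (2 ℕ.^ k)))

  ^q-+ : ∀ x y → (x + y) ^ q ≡ x ^ q + y ^ q
  ^q-+ x y = subst (λ n → (x + y) ^ n ≡ x ^ n + y ^ n) (sym q≡2^1+j) (+-^-2^ x y (suc j))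

  ^q-* : ∀ x y → (x * y) ^ q ≡ x ^ q * y ^ q
  ^q-* x y = ^-*-distrib x y q

  0^q : 0# ^ q ≡ 0#
  0^q = subst (λ n → 0# ^ n ≡ 0#) (sym q≡2+) (zeroˡ _)

  ^q-injective : ∀ {x y} → x ^ q ≡ y ^ q → x ≡ y
  ^q-injective {x} {y} xq≡yq = x+y≡0⇒x≡y (^≡0⇒≡0 (x + y) q (trans (^q-+ x y) (x≡y⇒x+y≡0 xq≡yq)))

  ^q≡0⇒≡0 : ∀ {x} → x ^ q ≡ 0# → x ≡ 0#
  ^q≡0⇒≡0 xq≡0 = ^q-injective (trans xq≡0 (sym 0^q))

  InGFq-0 : InGFq 0#
  InGFq-0 = 0^q

  InGFq-1 : InGFq 1#
  InGFq-1 = 1^ q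

  InGFq-+ : ∀ {x y} → InGFq x → InGFq y → InGFq (x + y)
  InGFq-+ {x} {y} xq≡x yq≡y = trans (^q-+ x y) (cong₂ _+_ xq≡x yq≡y)

  InGFq-* : ∀ {x y} → InGFq x → InGFq y → InGFq (x * y)
  InGFq-* {x} {y} xq≡x yq≡y = trans (^q-* x y) (cong₂ _*_ xq≡x yq≡y)

  √_ : F → F
  √ x = x ^ (2 ℕ.^ j)

  √-square : ∀ {x} → InGFq x → √ x * √ x ≡ x
  √-square {x} xq≡x = begin
    x ^ (2 ℕ.^ j) * x ^ (2 ℕ.^ j)      ≡⟨ sym (^-+ x (2 ℕ.^ j) _) ⟩
    x ^ (2 ℕ.^ j ℕ.+ 2 ℕ.^ j)          ≡⟨ cong (λ n → x ^ (2 ℕ.^ j ℕ.+ n)) (sym (ℕ.+-identityʳ (2 ℕ.^ j))) ⟩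
    x ^ q′                             ≡⟨ cong (x ^_) (sym q≡2^1+j) ⟩
    x ^ q                              ≡⟨ xq≡x ⟩
    x                                  ∎
    where
    open ≡-Reasoning
    q′ : ℕ
    q′ = 2 ℕ.^ suc j

  InGFq-√ : ∀ {x} → InGFq x → InGFq (√ x)
  InGFq-√ {x} xq≡x = trans (^-^-comm x (2 ℕ.^ j) q) (cong √_ xq≡x)

  monomial : ∀ m → Vec F (suc m)
  monomial zero = 1# ∷ []
  monomial (suc m) = 0# ∷ monomial m

  eval-monomial : ∀ m x → eval (monomial m) x ≡ x ^ m
  eval-monomial zero x = refl
  eval-monomial (suc m) x = trans (+-identityˡ _) (cong (x *_) (eval-monomial m x))

  leading-monomial : ∀ m → leading (monomial m) ≡ 1#
  leading-monomial zero = refl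
  leading-monomial (suc m) = leading-monomial m

  module _ (enumeration : Fin (q ℕ.* q) ↔ F) where
    open Enumerated K enumeration using (element; element-injective)

    -- GF(q) is the root set of x^q + x, of degree q, while F has q² > q elements.
    ∃-non-GFq : ∃[ w ] ¬ InGFq w
    ∃-non-GFq with Fin.any? (λ i → ¬? ((element i ^ q) ≟ element i))
    ... | yes (i , ¬fixed) = element i , ¬fixed
    ... | no none = contradiction all-roots
          (no-more-roots-than-degree q′ xq+x (1≢0 ∘ trans (sym (leading-monomial m)))
            root (Fin.inject≤-injective q+1≤q² q+1≤q² _ _ ∘ element-injective))
      where
      m q′ : ℕ
      m = q ℕ.∸ 2
      q′ = suc (suc m)
      xq+x : Vec F (suc q′)
      xq+x = 0# ∷ 1# ∷ monomial m
      q+1≤q² : suc q′ ≤ q ℕ.* q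
      q+1≤q² = subst (λ n → suc n ≤ q ℕ.* q) q≡2+ (begin
        suc q       ≤⟨ ℕ.+-monoˡ-≤ q (ℕ.≤-trans (s≤s z≤n) 2≤q) ⟩
        q ℕ.+ q     ≡⟨ cong (q ℕ.+_) (sym (ℕ.+-identityʳ q)) ⟩
        2 ℕ.* q     ≤⟨ ℕ.*-monoˡ-≤ q 2≤q ⟩
        q ℕ.* q     ∎)
        where open ℕ.≤-Reasoning
      root : Fin (suc q′) → F
      root i = element (Fin.inject≤ i q+1≤q²)
      all-roots : ∀ i → eval xq+x (root i) ≡ 0#
      all-roots i = begin
        0# + x * (1# + x * eval (monomial m) x)   ≡⟨ +-identityˡ _ ⟩
        x * (1# + x * eval (monomial m) x)        ≡⟨ cong (λ y → x * (1# + x * y)) (eval-monomial m x) ⟩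
        x * (1# + x ^ suc m)                         ≡⟨ distribˡ x 1# _ ⟩
        x * 1# + x ^ q′                              ≡⟨ cong₂ _+_ (*-identityʳ x) (trans (cong (x ^_) (sym q≡2+)) x-fixed) ⟩
        x + x                                        ≡⟨ x+x≡0 x ⟩
        0#                                           ∎
        where
        open ≡-Reasoning
        x : F
        x = root i
        x-fixed : x ^ q ≡ x
        x-fixed = decidable-stable ((x ^ q) ≟ x) (λ ¬fixed → none (_ , ¬fixed))

module Collineations (K : Field) (char2 : Field._+_ K (Field.1# K) (Field.1# K) ≡ Field.0# K)
                     (_≟_ : DecidableEquality (Field.Carrier K))
                     (q j : ℕ) (q≡2^1+j : q ≡ 2 ℕ.^ suc j)
                     (σ : Field.Carrier K) (σ∈GFq : Geometry.InGFq K q σ) (σ≢0 : σ ≢ Field.0# K) where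
  open Field K renaming (Carrier to F)
  open IsCommutativeRing isCommutativeRing
    using (+-comm; +-identityˡ; +-identityʳ; *-identityˡ; *-identityʳ; zeroˡ; zeroʳ; distribˡ)
  open FieldProperties K
  open GroupProperties (AbelianGroup.group (CommutativeRing.+-abelianGroup commutativeRing))
    using () renaming (∙-cancelˡ to +-cancelˡ; ∙-cancelʳ to +-cancelʳ)
  open FieldProperties.WithDecidableEquality K _≟_
  open CharTwo K char2
  open CharTwo.WithDecidableEquality K char2 _≟_
  open Frobenius K char2 _≟_ q j q≡2^1+j
  open Geometry K q
  open WithSigma σ

  Q : V4 → F
  Q x = x 0F * x 3F + x 1F * x 1F + σ * x 1F * x 2F + x 2F * x 2F

  vec : F → F → F → F → V4
  vec x₀ x₁ x₂ x₃ 0F = x₀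
  vec x₀ x₁ x₂ x₃ 1F = x₁
  vec x₀ x₁ x₂ x₃ 2F = x₂
  vec x₀ x₁ x₂ x₃ 3F = x₃

  cong-V4 : ∀ {A : Set} (f : F → F → F → F → A) {x y : V4} → x ≗ y →
            f (x 0F) (x 1F) (x 2F) (x 3F) ≡ f (y 0F) (y 1F) (y 2F) (y 3F)
  cong-V4 f x≗y rewrite x≗y 0F | x≗y 1F | x≗y 2F | x≗y 3F = refl

  ·-congˡ : ∀ (M : Mat) {x y} → x ≗ y → M · x ≗ M · y
  ·-congˡ M x≗y i = cong-V4 (λ x₀ x₁ x₂ x₃ → (M · vec x₀ x₁ x₂ x₃) i) x≗y

  ·-congᴹ : ∀ {M N : Mat} → (∀ i k → M i k ≡ N i k) → ∀ x → M · x ≗ N · x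
  ·-congᴹ M≡N x i = cong-V4 (λ m₀ m₁ m₂ m₃ → m₀ * x 0F + m₁ * x 1F + m₂ * x 2F + m₃ * x 3F) (M≡N i)

  ≗-vec : ∀ {x x₀ x₁ x₂ x₃} → x 0F ≡ x₀ → x 1F ≡ x₁ → x 2F ≡ x₂ → x 3F ≡ x₃ → x ≗ vec x₀ x₁ x₂ x₃
  ≗-vec x₀≡ x₁≡ x₂≡ x₃≡ 0F = x₀≡
  ≗-vec x₀≡ x₁≡ x₂≡ x₃≡ 1F = x₁≡
  ≗-vec x₀≡ x₁≡ x₂≡ x₃≡ 2F = x₂≡
  ≗-vec x₀≡ x₁≡ x₂≡ x₃≡ 3F = x₃≡

  ≗⇒∼ : ∀ {x y} → x ≗ y → x ∼ y
  ≗⇒∼ x≗y = 1# , 1≢0 , (λ i → trans (x≗y i) (sym (*-identityˡ _)))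

  SameMap-refl : ∀ {f} → SameMap f f
  SameMap-refl x _ = ≗⇒∼ λ _ → refl

  drop-zero-multiple : ∀ {x y h w} → x ≡ y + h * w → h ≡ 0# → x ≡ y
  drop-zero-multiple {y = y} {w = w} x≡y+0w refl = trans x≡y+0w (x+0*y≡x y w)

  IsRational : Mat → Set
  IsRational M = ∀ i k → InGFq (M i k)

  mkMat-rational : ∀ {rows} → All (All InGFq) rows → IsRational (mkMat rows)
  mkMat-rational rows∈GFq i = lookup⁺ (lookup⁺ rows∈GFq i)

  frob-rational : ∀ {x} → (∀ i → InGFq (x i)) → ∀ e → frob e x ≗ x
  frob-rational x∈GFq false i = refl
  frob-rational x∈GFq true i = x∈GFq i

  vec-rational : ∀ {x₀ x₁ x₂ x₃} → InGFq x₀ → InGFq x₁ → InGFq x₂ → InGFq x₃ → ∀ i → InGFq (vec x₀ x₁ x₂ x₃ i)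
  vec-rational x₀∈ x₁∈ x₂∈ x₃∈ 0F = x₀∈
  vec-rational x₀∈ x₁∈ x₂∈ x₃∈ 1F = x₁∈
  vec-rational x₀∈ x₁∈ x₂∈ x₃∈ 2F = x₂∈
  vec-rational x₀∈ x₁∈ x₂∈ x₃∈ 3F = x₃∈

  gtMat : F → F → F → F → F → Mat
  gtMat a b c d v = mkMat
    ( (a * a ∷ 0#    ∷ σ * a * b     ∷ b * b ∷ [])
    ∷ (a * c ∷ 1#    ∷ v + σ * b * c ∷ b * d ∷ [])
    ∷ (0#    ∷ 0#    ∷ 1#            ∷ 0#    ∷ [])
    ∷ (c * c ∷ 0#    ∷ σ * c * d     ∷ d * d ∷ [])
    ∷ [])

  -- Syntactic copies of the definitions above, so that the ring solver can
  -- be stated directly in terms of B, Q, gMat, tMat and gtMat.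
  module Symbolic {n : ℕ} where
    private
      P : Set
      P = Polynomial n

    vecₚ : P → P → P → P → Fin 4 → P
    vecₚ x₀ x₁ x₂ x₃ 0F = x₀
    vecₚ x₀ x₁ x₂ x₃ 1F = x₁
    vecₚ x₀ x₁ x₂ x₃ 2F = x₂
    vecₚ x₀ x₁ x₂ x₃ 3F = x₃

    mkMatₚ : Vec (Vec P 4) 4 → Fin 4 → Fin 4 → P
    mkMatₚ rows i k = lookup (lookup rows i) k

    _·ₚ_ : (Fin 4 → Fin 4 → P) → (Fin 4 → P) → Fin 4 → P
    (M ·ₚ x) i = M i 0F :* x 0F :+ M i 1F :* x 1F :+ M i 2F :* x 2F :+ M i 3F :* x 3F

    Bₚ : P → (Fin 4 → P) → (Fin 4 → P) → P
    Bₚ s x y = x 0F :* y 3F :+ x 3F :* y 0F :+ s :* (x 1F :* y 2F :+ x 2F :* y 1F)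

    Qₚ : P → (Fin 4 → P) → P
    Qₚ s x = x 0F :* x 3F :+ x 1F :* x 1F :+ s :* x 1F :* x 2F :+ x 2F :* x 2F

    Eₚ : Fin 4 → Fin 4 → P
    Eₚ 0F = vecₚ 1ₚ 0ₚ 0ₚ 0ₚ
    Eₚ 1F = vecₚ 0ₚ 1ₚ 0ₚ 0ₚ
    Eₚ 2F = vecₚ 0ₚ 0ₚ 1ₚ 0ₚ
    Eₚ 3F = vecₚ 0ₚ 0ₚ 0ₚ 1ₚ

    gMatₚ : P → P → P → P → P → Fin 4 → Fin 4 → P
    gMatₚ s a b c d = mkMatₚ
      ( (a :* a ∷ 0ₚ ∷ s :* a :* b ∷ b :* b ∷ [])
      ∷ (a :* c ∷ 1ₚ ∷ s :* b :* c ∷ b :* d ∷ [])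
      ∷ (0ₚ     ∷ 0ₚ ∷ 1ₚ          ∷ 0ₚ     ∷ [])
      ∷ (c :* c ∷ 0ₚ ∷ s :* c :* d ∷ d :* d ∷ [])
      ∷ [])

    tMatₚ : P → Fin 4 → Fin 4 → P
    tMatₚ v = mkMatₚ
      ( (1ₚ ∷ 0ₚ ∷ 0ₚ ∷ 0ₚ ∷ [])
      ∷ (0ₚ ∷ 1ₚ ∷ v  ∷ 0ₚ ∷ [])
      ∷ (0ₚ ∷ 0ₚ ∷ 1ₚ ∷ 0ₚ ∷ [])
      ∷ (0ₚ ∷ 0ₚ ∷ 0ₚ ∷ 1ₚ ∷ [])
      ∷ [])

    gtMatₚ : P → P → P → P → P → P → Fin 4 → Fin 4 → P
    gtMatₚ s a b c d v = mkMatₚ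
      ( (a :* a ∷ 0ₚ ∷ s :* a :* b      ∷ b :* b ∷ [])
      ∷ (a :* c ∷ 1ₚ ∷ v :+ s :* b :* c ∷ b :* d ∷ [])
      ∷ (0ₚ     ∷ 0ₚ ∷ 1ₚ               ∷ 0ₚ     ∷ [])
      ∷ (c :* c ∷ 0ₚ ∷ s :* c :* d      ∷ d :* d ∷ [])
      ∷ [])

  open Symbolic

  vanishing-combination : ∀ {x e₁ e₂ e₃ p₁ p₂ p₃} → x ≡ e₁ * p₁ + e₂ * p₂ + e₃ * p₃ →
                          e₁ ≡ 0# → e₂ ≡ 0# → e₃ ≡ 0# → x ≡ 0#
  vanishing-combination {p₁ = p₁} {p₂} {p₃} x≡ refl refl refl =
    trans x≡ (solve 3 (λ p₁ p₂ p₃ → 0ₚ :* p₁ :+ 0ₚ :* p₂ :+ 0ₚ :* p₃ := 0ₚ) refl p₁ p₂ p₃)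

  -- G and T in PSp(4, q)

  gMat-rational : ∀ {a b c d} → GParams a b c d → IsRational (gMat a b c d)
  gMat-rational (a∈ , b∈ , c∈ , d∈ , _) = mkMat-rational
    ( (InGFq-* a∈ a∈ ∷ InGFq-0 ∷ InGFq-* (InGFq-* σ∈GFq a∈) b∈ ∷ InGFq-* b∈ b∈ ∷ [])
    ∷ (InGFq-* a∈ c∈ ∷ InGFq-1 ∷ InGFq-* (InGFq-* σ∈GFq b∈) c∈ ∷ InGFq-* b∈ d∈ ∷ [])
    ∷ (InGFq-0       ∷ InGFq-0 ∷ InGFq-1                       ∷ InGFq-0       ∷ [])
    ∷ (InGFq-* c∈ c∈ ∷ InGFq-0 ∷ InGFq-* (InGFq-* σ∈GFq c∈) d∈ ∷ InGFq-* d∈ d∈ ∷ [])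
    ∷ [])

  tMat-rational : ∀ {v} → InGFq v → IsRational (tMat v)
  tMat-rational v∈ = mkMat-rational
    ( (InGFq-1 ∷ InGFq-0 ∷ InGFq-0 ∷ InGFq-0 ∷ [])
    ∷ (InGFq-0 ∷ InGFq-1 ∷ v∈      ∷ InGFq-0 ∷ [])
    ∷ (InGFq-0 ∷ InGFq-0 ∷ InGFq-1 ∷ InGFq-0 ∷ [])
    ∷ (InGFq-0 ∷ InGFq-0 ∷ InGFq-0 ∷ InGFq-1 ∷ [])
    ∷ [])

  -- Since (ad + bc)² + 1 = (ad + bc + 1)², the defect is a multiple of ad + bc + 1.
  B-gMat : ∀ a b c d x y → B (gMat a b c d · x) (gMat a b c d · y) ≡
           B x y + (a * d + b * c + 1#) * ((a * d + b * c + 1#) * (x 0F * y 3F + x 3F * y 0F)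
                     + σ * (a * c * (x 0F * y 2F + x 2F * y 0F) + b * d * (x 2F * y 3F + x 3F * y 2F)))
  B-gMat a b c d x y = solve 13 (λ s a b c d x₀ x₁ x₂ x₃ y₀ y₁ y₂ y₃ →
      Bₚ s (gMatₚ s a b c d ·ₚ vecₚ x₀ x₁ x₂ x₃) (gMatₚ s a b c d ·ₚ vecₚ y₀ y₁ y₂ y₃)
    := Bₚ s (vecₚ x₀ x₁ x₂ x₃) (vecₚ y₀ y₁ y₂ y₃)
       :+ (a :* d :+ b :* c :+ 1ₚ) :* ((a :* d :+ b :* c :+ 1ₚ) :* (x₀ :* y₃ :+ x₃ :* y₀)
                                      :+ s :* (a :* c :* (x₀ :* y₂ :+ x₂ :* y₀) :+ b :* d :* (x₂ :* y₃ :+ x₃ :* y₂))))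
    refl σ a b c d (x 0F) (x 1F) (x 2F) (x 3F) (y 0F) (y 1F) (y 2F) (y 3F)

  gMat-symplectic : ∀ {a b c d} → GParams a b c d → IsSymplecticGFq (gMat a b c d)
  gMat-symplectic {a} {b} {c} {d} params@(_ , _ , _ , _ , ad+bc≡1) = gMat-rational params , λ x y →
    drop-zero-multiple (B-gMat a b c d x y) (x≡y⇒x+y≡0 ad+bc≡1)

  tMat-symplectic : ∀ {v} → InGFq v → IsSymplecticGFq (tMat v)
  tMat-symplectic {v} v∈ = tMat-rational v∈ , λ x y → solve 10 (λ s v x₀ x₁ x₂ x₃ y₀ y₁ y₂ y₃ →
      Bₚ s (tMatₚ v ·ₚ vecₚ x₀ x₁ x₂ x₃) (tMatₚ v ·ₚ vecₚ y₀ y₁ y₂ y₃)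
    := Bₚ s (vecₚ x₀ x₁ x₂ x₃) (vecₚ y₀ y₁ y₂ y₃))
    refl σ v (x 0F) (x 1F) (x 2F) (x 3F) (y 0F) (y 1F) (y 2F) (y 3F)

  gMat-tMat-comm : ∀ a b c d v x → gMat a b c d · (tMat v · x) ≗ tMat v · (gMat a b c d · x)
  gMat-tMat-comm a b c d v x = row
    where
    sides : Fin 4 → (s a b c d v x₀ x₁ x₂ x₃ : Polynomial 10) → Polynomial 10 × Polynomial 10
    sides i s a b c d v x₀ x₁ x₂ x₃ =
      (gMatₚ s a b c d ·ₚ (tMatₚ v ·ₚ vecₚ x₀ x₁ x₂ x₃)) i
      := (tMatₚ v ·ₚ (gMatₚ s a b c d ·ₚ vecₚ x₀ x₁ x₂ x₃)) i
    row : gMat a b c d · (tMat v · x) ≗ tMat v · (gMat a b c d · x)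
    row 0F = solve 10 (sides 0F) refl σ a b c d v (x 0F) (x 1F) (x 2F) (x 3F)
    row 1F = solve 10 (sides 1F) refl σ a b c d v (x 0F) (x 1F) (x 2F) (x 3F)
    row 2F = solve 10 (sides 2F) refl σ a b c d v (x 0F) (x 1F) (x 2F) (x 3F)
    row 3F = solve 10 (sides 3F) refl σ a b c d v (x 0F) (x 1F) (x 2F) (x 3F)

  gMat-tMat≡gtMat : ∀ a b c d v x → gMat a b c d · (tMat v · x) ≗ gtMat a b c d v · x
  gMat-tMat≡gtMat a b c d v x = row
    where
    sides : Fin 4 → (s a b c d v x₀ x₁ x₂ x₃ : Polynomial 10) → Polynomial 10 × Polynomial 10
    sides i s a b c d v x₀ x₁ x₂ x₃ =
      (gMatₚ s a b c d ·ₚ (tMatₚ v ·ₚ vecₚ x₀ x₁ x₂ x₃)) i := (gtMatₚ s a b c d v ·ₚ vecₚ x₀ x₁ x₂ x₃) i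
    row : gMat a b c d · (tMat v · x) ≗ gtMat a b c d v · x
    row 0F = solve 10 (sides 0F) refl σ a b c d v (x 0F) (x 1F) (x 2F) (x 3F)
    row 1F = solve 10 (sides 1F) refl σ a b c d v (x 0F) (x 1F) (x 2F) (x 3F)
    row 2F = solve 10 (sides 2F) refl σ a b c d v (x 0F) (x 1F) (x 2F) (x 3F)
    row 3F = solve 10 (sides 3F) refl σ a b c d v (x 0F) (x 1F) (x 2F) (x 3F)

  rational-commutes-with-frob : ∀ {M} → IsRational M → ∀ x → M · frob true x ≗ frob true (M · x)
  rational-commutes-with-frob {M} M∈GFq x i = sym (
    trans (^q-+ _ _) (cong₂ _+_
      (trans (^q-+ _ _) (cong₂ _+_
        (trans (^q-+ _ _) (cong₂ _+_ (term 0F) (term 1F)))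
        (term 2F)))
      (term 3F)))
    where
    term : ∀ k → (M i k * x k) ^ q ≡ M i k * x k ^ q
    term k = trans (^q-* (M i k) (x k)) (cong (_* x k ^ q) (M∈GFq i k))

  gtτ-rational : ∀ a b c d v e {x} → (∀ i → InGFq (x i)) → gtτ a b c d v e x ≗ gtMat a b c d v · x
  gtτ-rational a b c d v e {x} x∈GFq i =
    trans (gMat-tMat≡gtMat a b c d v (frob e x) i) (·-congˡ (gtMat a b c d v) (frob-rational x∈GFq e) i)

  -- Invariance of the conic

  Q-cong : ∀ {x y} → x ≗ y → Q x ≡ Q y
  Q-cong = cong-V4 (λ x₀ x₁ x₂ x₃ → Q (vec x₀ x₁ x₂ x₃))

  Q-scale : ∀ l y → Q (λ i → l * y i) ≡ (l * l) * Q y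
  Q-scale l y = solve 6 (λ s l y₀ y₁ y₂ y₃ →
      Qₚ s (vecₚ (l :* y₀) (l :* y₁) (l :* y₂) (l :* y₃)) := l :* l :* Qₚ s (vecₚ y₀ y₁ y₂ y₃))
    refl σ l (y 0F) (y 1F) (y 2F) (y 3F)

  Q-frob : ∀ x → Q (frob true x) ≡ Q x ^ q
  Q-frob x = sym (begin
    (x₀ * x₃ + x₁ * x₁ + σ * x₁ * x₂ + x₂ * x₂) ^ q
      ≡⟨ trans (^q-+ _ _) (cong (_+ (x₂ * x₂) ^ q) (trans (^q-+ _ _) (cong (_+ (σ * x₁ * x₂) ^ q) (^q-+ _ _)))) ⟩
    (x₀ * x₃) ^ q + (x₁ * x₁) ^ q + (σ * x₁ * x₂) ^ q + (x₂ * x₂) ^ q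
      ≡⟨ cong₂ _+_ (cong₂ _+_ (cong₂ _+_ (^q-* x₀ x₃) (^q-* x₁ x₁)) σx₁x₂^q) (^q-* x₂ x₂) ⟩
    x₀ ^ q * x₃ ^ q + x₁ ^ q * x₁ ^ q + σ * x₁ ^ q * x₂ ^ q + x₂ ^ q * x₂ ^ q ∎)
    where
    open ≡-Reasoning
    x₀ x₁ x₂ x₃ : F
    x₀ = x 0F
    x₁ = x 1F
    x₂ = x 2F
    x₃ = x 3F
    σx₁x₂^q : (σ * x₁ * x₂) ^ q ≡ σ * x₁ ^ q * x₂ ^ q
    σx₁x₂^q = trans (^q-* _ x₂) (cong (_* x₂ ^ q) (trans (^q-* σ x₁) (cong (_* x₁ ^ q) σ∈GFq)))

  InC-∼ : ∀ {x y} → x ∼ y → InC x ⇔ InC y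
  InC-∼ {x} {y} (l , l≢0 , x≗ly) = mk⇔
    (λ (x₂≡0 , Qx≡0) → nonzero-*-cancel l≢0 (trans (sym (x≗ly 2F)) x₂≡0) ,
                       nonzero-*-cancel l²≢0 (trans (sym Qx≡l²Qy) Qx≡0))
    (λ (y₂≡0 , Qy≡0) → trans (x≗ly 2F) (trans (cong (l *_) y₂≡0) (zeroʳ l)) ,
                       trans Qx≡l²Qy (trans (cong (l * l *_) Qy≡0) (zeroʳ _)))
    where
    l²≢0 : l * l ≢ 0#
    l²≢0 l²≡0 = [ l≢0 , l≢0 ]′ (zero-product l²≡0)
    Qx≡l²Qy : Q x ≡ (l * l) * Q y
    Qx≡l²Qy = trans (Q-cong x≗ly) (Q-scale l y)

  InC-≗ : ∀ {x y} → x ≗ y → InC x ⇔ InC y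
  InC-≗ = InC-∼ ∘ ≗⇒∼

  InC-frob : ∀ e x → InC (frob e x) ⇔ InC x
  InC-frob false x = ⇔-id _
  InC-frob true x = mk⇔
    (λ (x₂^q≡0 , Q≡0) → ^q≡0⇒≡0 x₂^q≡0 , ^q≡0⇒≡0 (trans (sym (Q-frob x)) Q≡0))
    (λ (x₂≡0 , Q≡0) → trans (cong (_^ q) x₂≡0) 0^q , trans (Q-frob x) (trans (cong (_^ q) Q≡0) 0^q))

  plane : V4 → V4
  plane y = vec (y 0F) (y 1F) 0# (y 3F)

  on-plane : ∀ y → y 2F ≡ 0# → y ≗ plane y
  on-plane y y₂≡0 0F = refl
  on-plane y y₂≡0 1F = refl
  on-plane y y₂≡0 2F = y₂≡0
  on-plane y y₂≡0 3F = refl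

  InC-by-plane : ∀ {x y} → x 2F ≡ y 2F → (y 2F ≡ 0# → Q x ≡ Q y) → InC x ⇔ InC y
  InC-by-plane x₂≡y₂ Qx≡Qy = mk⇔
    (λ (x₂≡0 , Qx≡0) → let y₂≡0 = trans (sym x₂≡y₂) x₂≡0 in y₂≡0 , trans (sym (Qx≡Qy y₂≡0)) Qx≡0)
    (λ (y₂≡0 , Qy≡0) → trans x₂≡y₂ y₂≡0 , trans (Qx≡Qy y₂≡0) Qy≡0)

  InC-tMat : ∀ v y → InC (tMat v · y) ⇔ InC y
  InC-tMat v y = InC-by-plane {tMat v · y} {y} row₂ λ y₂≡0 → begin
    Q (tMat v · y)        ≡⟨ Q-cong (·-congˡ (tMat v) (on-plane y y₂≡0)) ⟩
    Q (tMat v · plane y)  ≡⟨ solve 5 (λ s v y₀ y₁ y₃ → Qₚ s (tMatₚ v ·ₚ vecₚ y₀ y₁ 0ₚ y₃)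
                                                    := Qₚ s (vecₚ y₀ y₁ 0ₚ y₃)) refl σ v (y 0F) (y 1F) (y 3F) ⟩
    Q (plane y)           ≡⟨ Q-cong (on-plane y y₂≡0) ⟨
    Q y                   ∎
    where
    open ≡-Reasoning
    row₂ : (tMat v · y) 2F ≡ y 2F
    row₂ = solve 5 (λ v y₀ y₁ y₂ y₃ → (tMatₚ v ·ₚ vecₚ y₀ y₁ y₂ y₃) 2F := y₂) refl v (y 0F) (y 1F) (y 2F) (y 3F)

  InC-gMat : ∀ {a b c d} → a * d + b * c ≡ 1# → ∀ y → InC (gMat a b c d · y) ⇔ InC y
  InC-gMat {a} {b} {c} {d} ad+bc≡1 y = InC-by-plane {gMat a b c d · y} {y} row₂ λ y₂≡0 → begin
    Q (gMat a b c d · y)        ≡⟨ Q-cong (·-congˡ (gMat a b c d) (on-plane y y₂≡0)) ⟩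
    Q (gMat a b c d · plane y)  ≡⟨ drop-zero-multiple (Q-gMat-plane y) (x≡y⇒x+y≡0 ad+bc≡1) ⟩
    Q (plane y)                 ≡⟨ Q-cong (on-plane y y₂≡0) ⟨
    Q y                         ∎
    where
    open ≡-Reasoning
    row₂ : (gMat a b c d · y) 2F ≡ y 2F
    row₂ = solve 9 (λ s a b c d y₀ y₁ y₂ y₃ → (gMatₚ s a b c d ·ₚ vecₚ y₀ y₁ y₂ y₃) 2F := y₂)
      refl σ a b c d (y 0F) (y 1F) (y 2F) (y 3F)
    Q-gMat-plane : ∀ y → Q (gMat a b c d · plane y) ≡
                         Q (plane y) + (a * d + b * c + 1#) * ((a * d + b * c + 1#) * (y 0F * y 3F))
    Q-gMat-plane y = solve 8 (λ s a b c d y₀ y₁ y₃ →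
        Qₚ s (gMatₚ s a b c d ·ₚ vecₚ y₀ y₁ 0ₚ y₃)
      := Qₚ s (vecₚ y₀ y₁ 0ₚ y₃) :+ (a :* d :+ b :* c :+ 1ₚ) :* ((a :* d :+ b :* c :+ 1ₚ) :* (y₀ :* y₃)))
      refl σ a b c d (y 0F) (y 1F) (y 3F)

  gtτ-stabilizes : ∀ {a b c d} → a * d + b * c ≡ 1# → ∀ v e → Stabilizes (gtτ a b c d v e)
  gtτ-stabilizes ad+bc≡1 v e x _ =
    ⇔-sym (InC-frob e x ⇔-∘ (InC-tMat v (frob e x) ⇔-∘ InC-gMat ad+bc≡1 (tMat v · frob e x)))

  SameMap-stabilizes : ∀ {f g} → SameMap f g → Stabilizes g → Stabilizes f
  SameMap-stabilizes f∼g g-stab x x≢0 = ⇔-sym (InC-∼ (f∼g x x≢0)) ⇔-∘ g-stab x x≢0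

  -- Points of the conic and columns of a matrix

  frob₁ : Bool → F → F
  frob₁ false t = t
  frob₁ true t = t ^ q

  frob₁-0 : ∀ e → frob₁ e 0# ≡ 0#
  frob₁-0 false = refl
  frob₁-0 true = InGFq-0

  frob₁-1 : ∀ e → frob₁ e 1# ≡ 1#
  frob₁-1 false = refl
  frob₁-1 true = InGFq-1

  frob₁-+1 : ∀ e t → frob₁ e (t + 1#) ≡ frob₁ e t + 1#
  frob₁-+1 false t = refl
  frob₁-+1 true t = trans (^q-+ t 1#) (cong (t ^ q +_) InGFq-1)

  frob₁-≢0 : ∀ e {t} → t ≢ 0# → frob₁ e t ≢ 0#
  frob₁-≢0 false t≢0 = t≢0
  frob₁-≢0 true t≢0 = t≢0 ∘ ^q≡0⇒≡0

  frob₁-≢1 : ∀ e {t} → t ≢ 1# → frob₁ e t + 1# ≢ 0#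
  frob₁-≢1 false t≢1 = t≢1 ∘ x+y≡0⇒x≡y
  frob₁-≢1 true t≢1 = t≢1 ∘ ^q-injective ∘ (λ tq≡1 → trans tq≡1 (sym InGFq-1)) ∘ x+y≡0⇒x≡y

  P : F → V4
  P s = vec 1# s 0# (s * s)

  E : Fin 4 → V4
  E 0F = vec 1# 0# 0# 0#
  E 1F = vec 0# 1# 0# 0#
  E 2F = vec 0# 0# 1# 0#
  E 3F = vec 0# 0# 0# 1#

  P-on-C : ∀ s → InC (P s)
  P-on-C s = refl , solve 2 (λ s t → Qₚ s (vecₚ 1ₚ t 0ₚ (t :* t)) := 0ₚ) refl σ s

  E₃-on-C : InC (E 3F)
  E₃-on-C = refl , solve 1 (λ s → Qₚ s (vecₚ 0ₚ 0ₚ 0ₚ 1ₚ) := 0ₚ) refl σ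

  P-nonzero : ∀ s → NonZero (P s)
  P-nonzero s P≡0 = 1≢0 (P≡0 0F)

  E-nonzero : ∀ k → NonZero (E k)
  E-nonzero 0F E≡0 = 1≢0 (E≡0 0F)
  E-nonzero 1F E≡0 = 1≢0 (E≡0 1F)
  E-nonzero 2F E≡0 = 1≢0 (E≡0 2F)
  E-nonzero 3F E≡0 = 1≢0 (E≡0 3F)

  E-rational : ∀ k i → InGFq (E k i)
  E-rational 0F = vec-rational InGFq-1 InGFq-0 InGFq-0 InGFq-0
  E-rational 1F = vec-rational InGFq-0 InGFq-1 InGFq-0 InGFq-0
  E-rational 2F = vec-rational InGFq-0 InGFq-0 InGFq-1 InGFq-0
  E-rational 3F = vec-rational InGFq-0 InGFq-0 InGFq-0 InGFq-1

  frob-P : ∀ e t → frob e (P t) ≗ P (frob₁ e t)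
  frob-P false t i = refl
  frob-P true t 0F = InGFq-1
  frob-P true t 1F = refl
  frob-P true t 2F = InGFq-0
  frob-P true t 3F = ^q-* t t

  column : Mat → Fin 4 → V4
  column M k i = M i k

  ·-E : ∀ M k → M · E k ≗ column M k
  ·-E M 0F i = solve 4 (λ m₀ m₁ m₂ m₃ → m₀ :* 1ₚ :+ m₁ :* 0ₚ :+ m₂ :* 0ₚ :+ m₃ :* 0ₚ := m₀)
    refl (M i 0F) (M i 1F) (M i 2F) (M i 3F)
  ·-E M 1F i = solve 4 (λ m₀ m₁ m₂ m₃ → m₀ :* 0ₚ :+ m₁ :* 1ₚ :+ m₂ :* 0ₚ :+ m₃ :* 0ₚ := m₁)
    refl (M i 0F) (M i 1F) (M i 2F) (M i 3F)
  ·-E M 2F i = solve 4 (λ m₀ m₁ m₂ m₃ → m₀ :* 0ₚ :+ m₁ :* 0ₚ :+ m₂ :* 1ₚ :+ m₃ :* 0ₚ := m₂)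
    refl (M i 0F) (M i 1F) (M i 2F) (M i 3F)
  ·-E M 3F i = solve 4 (λ m₀ m₁ m₂ m₃ → m₀ :* 0ₚ :+ m₁ :* 0ₚ :+ m₂ :* 0ₚ :+ m₃ :* 1ₚ := m₃)
    refl (M i 0F) (M i 1F) (M i 2F) (M i 3F)

  ·-P : ∀ M s → M · P s ≗ λ i → M i 0F + s * (M i 1F + s * M i 3F)
  ·-P M s i = solve 5 (λ m₀ m₁ m₂ m₃ s → m₀ :* 1ₚ :+ m₁ :* s :+ m₂ :* 0ₚ :+ m₃ :* (s :* s) := m₀ :+ s :* (m₁ :+ s :* m₃))
    refl (M i 0F) (M i 1F) (M i 2F) (M i 3F) s

  B-cong : ∀ {x x′ y y′} → x ≗ x′ → y ≗ y′ → B x y ≡ B x′ y′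
  B-cong {x} {x′} {y} {y′} x≗x′ y≗y′ =
    trans (cong-V4 (λ x₀ x₁ x₂ x₃ → B (vec x₀ x₁ x₂ x₃) y) x≗x′)
          (cong-V4 (λ y₀ y₁ y₂ y₃ → B x′ (vec y₀ y₁ y₂ y₃)) y≗y′)

  B-columns : ∀ {M} → IsSymplecticGFq M → ∀ k l → B (column M k) (column M l) ≡ B (E k) (E l)
  B-columns {M} (_ , M-preserves-B) k l =
    trans (B-cong (sym ∘ ·-E M k) (sym ∘ ·-E M l)) (M-preserves-B (E k) (E l))

  -- B is the polar form of Q.
  Q-curve : ∀ u v z s → Q (λ i → u i + s * (v i + s * z i)) ≡ Q u + s * (B u v + s * (B u z + Q v + s * (B v z + s * Q z)))
  Q-curve u v z s = solve 14 (λ σ s u₀ u₁ u₂ u₃ v₀ v₁ v₂ v₃ z₀ z₁ z₂ z₃ →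
      let uₚ = vecₚ u₀ u₁ u₂ u₃ ; vₚ = vecₚ v₀ v₁ v₂ v₃ ; zₚ = vecₚ z₀ z₁ z₂ z₃ in
      Qₚ σ (λ i → uₚ i :+ s :* (vₚ i :+ s :* zₚ i))
    := Qₚ σ uₚ :+ s :* (Bₚ σ uₚ vₚ :+ s :* (Bₚ σ uₚ zₚ :+ Qₚ σ vₚ :+ s :* (Bₚ σ vₚ zₚ :+ s :* Qₚ σ zₚ))))
    refl σ s (u 0F) (u 1F) (u 2F) (u 3F) (v 0F) (v 1F) (v 2F) (v 3F) (z 0F) (z 1F) (z 2F) (z 3F)

  Q-plane : ∀ x → x 2F ≡ 0# → Q x ≡ x 0F * x 3F + x 1F * x 1F
  Q-plane x x₂≡0 = trans (Q-cong (on-plane x x₂≡0))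
    (solve 4 (λ σ x₀ x₁ x₃ → Qₚ σ (vecₚ x₀ x₁ 0ₚ x₃) := x₀ :* x₃ :+ x₁ :* x₁) refl σ (x 0F) (x 1F) (x 3F))

  B-plane : ∀ x y → x 2F ≡ 0# → y 2F ≡ 0# → B x y ≡ x 0F * y 3F + x 3F * y 0F
  B-plane x y x₂≡0 y₂≡0 = trans (B-cong (on-plane x x₂≡0) (on-plane y y₂≡0))
    (solve 7 (λ σ x₀ x₁ x₃ y₀ y₁ y₃ → Bₚ σ (vecₚ x₀ x₁ 0ₚ x₃) (vecₚ y₀ y₁ 0ₚ y₃) := x₀ :* y₃ :+ x₃ :* y₀)
      refl σ (x 0F) (x 1F) (x 3F) (y 0F) (y 1F) (y 3F))

  plane-conic-point : ∀ x → x 2F ≡ 0# → Q x ≡ 0# → x 1F * x 1F ≡ x 0F * x 3F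
  plane-conic-point x x₂≡0 Qx≡0 = sym (x+y≡0⇒x≡y (trans (sym (Q-plane x x₂≡0)) Qx≡0))

  -- On the plane X₂ = 0, B only involves the coordinates 0 and 3.
  orthogonal-to-hyperbolic-pair : ∀ u v z → u 2F ≡ 0# → v 2F ≡ 0# → z 2F ≡ 0# →
    B u z ≡ 1# → B u v ≡ 0# → B v z ≡ 0# → v 0F ≡ 0# × v 3F ≡ 0#
  orthogonal-to-hyperbolic-pair u v z u₂≡0 v₂≡0 z₂≡0 Buz≡1 Buv≡0 Bvz≡0 =
    coordinate (v 0F) (solve 6 (λ u₀ u₃ v₀ v₃ z₀ z₃ →
                         v₀ :* (u₀ :* z₃ :+ u₃ :* z₀) := u₀ :* (v₀ :* z₃ :+ v₃ :* z₀) :+ z₀ :* (u₀ :* v₃ :+ u₃ :* v₀))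
                       refl (u 0F) (u 3F) (v 0F) (v 3F) (z 0F) (z 3F)) ,
    coordinate (v 3F) (solve 6 (λ u₀ u₃ v₀ v₃ z₀ z₃ →
                         v₃ :* (u₀ :* z₃ :+ u₃ :* z₀) := u₃ :* (v₀ :* z₃ :+ v₃ :* z₀) :+ z₃ :* (u₀ :* v₃ :+ u₃ :* v₀))
                       refl (u 0F) (u 3F) (v 0F) (v 3F) (z 0F) (z 3F))
    where
    coordinate : ∀ x {m n} →
      x * (u 0F * z 3F + u 3F * z 0F) ≡ m * (v 0F * z 3F + v 3F * z 0F) + n * (u 0F * v 3F + u 3F * v 0F) → x ≡ 0#
    coordinate x {m} {n} eq = begin
      x                                     ≡⟨ *-identityʳ x ⟨
      x * 1#                                ≡⟨ cong (x *_) (trans (sym Buz≡1) (B-plane u z u₂≡0 z₂≡0)) ⟩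
      x * (u 0F * z 3F + u 3F * z 0F)       ≡⟨ eq ⟩
      m * (v 0F * z 3F + v 3F * z 0F) + n * (u 0F * v 3F + u 3F * v 0F)
        ≡⟨ cong₂ (λ b b′ → m * b + n * b′) (trans (sym (B-plane v z v₂≡0 z₂≡0)) Bvz≡0)
                                            (trans (sym (B-plane u v u₂≡0 v₂≡0)) Buv≡0) ⟩
      m * 0# + n * 0#                       ≡⟨ cong₂ _+_ (zeroʳ m) (zeroʳ n) ⟩
      0# + 0#                               ≡⟨ +-identityʳ 0# ⟩
      0#                                    ∎
      where open ≡-Reasoning

  linear-system : ∀ {a b c d y₀ y₃} → a * d + b * c ≡ 1# →
    a * a * y₃ + c * c * y₀ + σ * (a * c) ≡ 0# → b * b * y₃ + d * d * y₀ + σ * (b * d) ≡ 0# →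
    y₀ ≡ σ * a * b × y₃ ≡ σ * c * d
  linear-system {a} {b} {c} {d} {y₀} {y₃} ad+bc≡1 e₁≡0 e₂≡0 =
    x+y≡0⇒x≡y (vanishing-combination (solve 7 (λ σ a b c d y₀ y₃ → y₀ :+ σ :* a :* b :=
        (a :* a :* y₃ :+ c :* c :* y₀ :+ σ :* (a :* c)) :* (b :* b) :+ (b :* b :* y₃ :+ d :* d :* y₀ :+ σ :* (b :* d)) :* (a :* a)
        :+ (a :* d :+ b :* c :+ 1ₚ) :* ((a :* d :+ b :* c :+ 1ₚ) :* y₀ :+ σ :* a :* b)) refl σ a b c d y₀ y₃) e₁≡0 e₂≡0 D+1≡0) ,
    x+y≡0⇒x≡y (vanishing-combination (solve 7 (λ σ a b c d y₀ y₃ → y₃ :+ σ :* c :* d :=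
        (a :* a :* y₃ :+ c :* c :* y₀ :+ σ :* (a :* c)) :* (d :* d) :+ (b :* b :* y₃ :+ d :* d :* y₀ :+ σ :* (b :* d)) :* (c :* c)
        :+ (a :* d :+ b :* c :+ 1ₚ) :* ((a :* d :+ b :* c :+ 1ₚ) :* y₃ :+ σ :* c :* d)) refl σ a b c d y₀ y₃) e₁≡0 e₂≡0 D+1≡0)
    where
    D+1≡0 : a * d + b * c + 1# ≡ 0#
    D+1≡0 = x≡y⇒x+y≡0 ad+bc≡1

  -- Stabilising elements of ⟨PSp(4, q), τ⟩

  module StabilizerElement {w : F} (w≢0 : w ≢ 0#) (w≢1 : w ≢ 1#) {M : Mat} {e : Bool}
                           (M-symplectic : IsSymplecticGFq M) (M-stabilizes : Stabilizes (act M e)) where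
    open Equivalence using (to)

    M-rational : IsRational M
    M-rational = proj₁ M-symplectic

    u v y z : V4
    u = column M 0F
    v = column M 1F
    y = column M 2F
    z = column M 3F

    -- the image under M of the point P s of the conic
    curve : F → V4
    curve s i = u i + s * (v i + s * z i)

    curve-on-C : ∀ {s} t → frob₁ e t ≡ s → InC (curve s)
    curve-on-C t refl = to (InC-≗ (λ i → trans (·-congˡ M (frob-P e t) i) (·-P M (frob₁ e t) i)))
                          (to (M-stabilizes (P t) (P-nonzero t)) (P-on-C t))

    z-on-C : InC z
    z-on-C = to (InC-≗ (λ i → trans (·-congˡ M (frob-rational (E-rational 3F) e) i) (·-E M 3F i)))
               (to (M-stabilizes (E 3F) (E-nonzero 3F)) E₃-on-C)

    u₂≡0 : u 2F ≡ 0#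
    u₂≡0 = trans (sym (x+0*y≡x (u 2F) _)) (proj₁ (curve-on-C 0# (frob₁-0 e)))

    z₂≡0 : z 2F ≡ 0#
    z₂≡0 = proj₁ z-on-C

    v₂≡0 : v 2F ≡ 0#
    v₂≡0 = begin
      v 2F                             ≡⟨ solve 1 (λ x → x := 0ₚ :+ 1ₚ :* (x :+ 1ₚ :* 0ₚ)) refl (v 2F) ⟩
      0# + 1# * (v 2F + 1# * 0#)       ≡⟨ cong₂ (λ x y → x + 1# * (v 2F + 1# * y)) u₂≡0 z₂≡0 ⟨
      u 2F + 1# * (v 2F + 1# * z 2F)   ≡⟨ proj₁ (curve-on-C 1# (frob₁-1 e)) ⟩
      0#                               ∎
      where open ≡-Reasoning

    Qu≡0 : Q u ≡ 0#
    Qu≡0 = trans (sym (x+0*y≡x (Q u) _)) (trans (sym (Q-curve u v z 0#)) (proj₂ (curve-on-C 0# (frob₁-0 e))))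

    Qz≡0 : Q z ≡ 0#
    Qz≡0 = proj₂ z-on-C

    c₁ c₂ c₃ : F
    c₁ = B u v
    c₂ = B u z + Q v
    c₃ = B v z

    -- Q (curve s) is a quartic in s whose constant and leading coefficients Q u, Q z vanish.
    cubic-root : ∀ {s} → s ≢ 0# → InC (curve s) → c₁ + s * (c₂ + s * c₃) ≡ 0#
    cubic-root {s} s≢0 curve-s-on-C = nonzero-*-cancel s≢0 (begin
      s * (c₁ + s * (c₂ + s * c₃))                    ≡⟨ solve 4 (λ s c₁ c₂ c₃ → s :* (c₁ :+ s :* (c₂ :+ s :* c₃))
                                                            := 0ₚ :+ s :* (c₁ :+ s :* (c₂ :+ s :* (c₃ :+ s :* 0ₚ)))) refl s c₁ c₂ c₃ ⟩
      0# + s * (c₁ + s * (c₂ + s * (c₃ + s * 0#)))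
        ≡⟨ cong₂ (λ x y → x + s * (c₁ + s * (c₂ + s * (c₃ + s * y)))) Qu≡0 Qz≡0 ⟨
      Q u + s * (c₁ + s * (c₂ + s * (c₃ + s * Q z)))  ≡⟨ Q-curve u v z s ⟨
      Q (curve s)                                     ≡⟨ proj₂ curve-s-on-C ⟩
      0#                                              ∎)
      where open ≡-Reasoning

    coefficients-vanish : c₁ ≡ 0# × c₂ ≡ 0# × c₃ ≡ 0#
    coefficients-vanish = three-roots⇒zero (frob₁-≢0 e w≢0) (frob₁-≢1 e w≢1)
      (cubic-root 1≢0 (curve-on-C 1# (frob₁-1 e)))
      (cubic-root (frob₁-≢0 e w≢0) (curve-on-C w refl))
      (cubic-root (frob₁-≢1 e w≢1) (curve-on-C (w + 1#) (frob₁-+1 e w)))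

    c₁≡0 : c₁ ≡ 0#
    c₁≡0 = proj₁ coefficients-vanish

    c₂≡0 : c₂ ≡ 0#
    c₂≡0 = proj₁ (proj₂ coefficients-vanish)

    c₃≡0 : c₃ ≡ 0#
    c₃≡0 = proj₂ (proj₂ coefficients-vanish)

    Buz≡1 : B u z ≡ 1#
    Buz≡1 = trans (B-columns M-symplectic 0F 3F) (solve 1 (λ s → Bₚ s (Eₚ 0F) (Eₚ 3F) := 1ₚ) refl σ)

    Buy≡0 : B u y ≡ 0#
    Buy≡0 = trans (B-columns M-symplectic 0F 2F) (solve 1 (λ s → Bₚ s (Eₚ 0F) (Eₚ 2F) := 0ₚ) refl σ)

    Bvy≡σ : B v y ≡ σ
    Bvy≡σ = trans (B-columns M-symplectic 1F 2F) (solve 1 (λ s → Bₚ s (Eₚ 1F) (Eₚ 2F) := s) refl σ)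

    Bzy≡0 : B z y ≡ 0#
    Bzy≡0 = trans (B-columns M-symplectic 3F 2F) (solve 1 (λ s → Bₚ s (Eₚ 3F) (Eₚ 2F) := 0ₚ) refl σ)

    v₀≡0 : v 0F ≡ 0#
    v₀≡0 = proj₁ (orthogonal-to-hyperbolic-pair u v z u₂≡0 v₂≡0 z₂≡0 Buz≡1 c₁≡0 c₃≡0)

    v₃≡0 : v 3F ≡ 0#
    v₃≡0 = proj₂ (orthogonal-to-hyperbolic-pair u v z u₂≡0 v₂≡0 z₂≡0 Buz≡1 c₁≡0 c₃≡0)

    v₁≡1 : v 1F ≡ 1#
    v₁≡1 = square-injective (begin
      v 1F * v 1F                 ≡⟨ +-identityˡ _ ⟨
      0# + v 1F * v 1F            ≡⟨ cong (_+ v 1F * v 1F) (zeroˡ (v 3F)) ⟨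
      0# * v 3F + v 1F * v 1F     ≡⟨ cong (λ x → x * v 3F + v 1F * v 1F) v₀≡0 ⟨
      v 0F * v 3F + v 1F * v 1F   ≡⟨ Q-plane v v₂≡0 ⟨
      Q v                         ≡⟨ x+y≡0⇒x≡y c₂≡0 ⟨
      B u z                       ≡⟨ Buz≡1 ⟩
      1#                          ≡⟨ *-identityˡ 1# ⟨
      1# * 1#                     ∎)
      where open ≡-Reasoning

    v-shape : v ≗ vec 0# 1# 0# 0#
    v-shape = ≗-vec v₀≡0 v₁≡1 v₂≡0 v₃≡0

    a b c d : F
    a = √ (u 0F)
    b = √ (z 0F)
    c = √ (u 3F)
    d = √ (z 3F)

    a² : a * a ≡ u 0F
    a² = √-square (M-rational 0F 0F)
    b² : b * b ≡ z 0F
    b² = √-square (M-rational 0F 3F)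
    c² : c * c ≡ u 3F
    c² = √-square (M-rational 3F 0F)
    d² : d * d ≡ z 3F
    d² = √-square (M-rational 3F 3F)

    u₁≡ac : u 1F ≡ a * c
    u₁≡ac = square-injective (trans (plane-conic-point u u₂≡0 Qu≡0) (sym (trans (square-* a c) (cong₂ _*_ a² c²))))

    z₁≡bd : z 1F ≡ b * d
    z₁≡bd = square-injective (trans (plane-conic-point z z₂≡0 Qz≡0) (sym (trans (square-* b d) (cong₂ _*_ b² d²))))

    ad+bc≡1 : a * d + b * c ≡ 1#
    ad+bc≡1 = square-injective (begin
      (a * d + b * c) * (a * d + b * c)   ≡⟨ solve 4 (λ a b c d → (a :* d :+ b :* c) :* (a :* d :+ b :* c)
                                                := a :* a :* (d :* d) :+ c :* c :* (b :* b)) refl a b c d ⟩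
      a * a * (d * d) + c * c * (b * b)   ≡⟨ cong₂ _+_ (cong₂ _*_ a² d²) (cong₂ _*_ c² b²) ⟩
      u 0F * z 3F + u 3F * z 0F           ≡⟨ B-plane u z u₂≡0 z₂≡0 ⟨
      B u z                               ≡⟨ Buz≡1 ⟩
      1#                                  ≡⟨ *-identityˡ 1# ⟨
      1# * 1#                             ∎)
      where open ≡-Reasoning

    u-shape : u ≗ vec (a * a) (a * c) 0# (c * c)
    u-shape = ≗-vec (sym a²) u₁≡ac u₂≡0 (sym c²)

    z-shape : z ≗ vec (b * b) (b * d) 0# (d * d)
    z-shape = ≗-vec (sym b²) z₁≡bd z₂≡0 (sym d²)

    y₂≡1 : y 2F ≡ 1#
    y₂≡1 = x+y≡0⇒x≡y (nonzero-*-cancel σ≢0 (begin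
      σ * (y 2F + 1#)              ≡⟨ solve 5 (λ σ y₀ y₁ y₂ y₃ → σ :* (y₂ :+ 1ₚ) := Bₚ σ (Eₚ 1F) (vecₚ y₀ y₁ y₂ y₃) :+ σ)
                                        refl σ (y 0F) (y 1F) (y 2F) (y 3F) ⟩
      B (vec 0# 1# 0# 0#) y + σ    ≡⟨ cong (_+ σ) (B-cong {y = y} (sym ∘ v-shape) λ _ → refl) ⟩
      B v y + σ                    ≡⟨ cong (_+ σ) Bvy≡σ ⟩
      σ + σ                        ≡⟨ x+x≡0 σ ⟩
      0#                           ∎))
      where open ≡-Reasoning

    y-shape : y ≗ vec (y 0F) (y 1F) 1# (y 3F)
    y-shape = ≗-vec {y} refl refl y₂≡1 refl

    y₀≡σab×y₃≡σcd : y 0F ≡ σ * a * b × y 3F ≡ σ * c * d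
    y₀≡σab×y₃≡σcd = linear-system ad+bc≡1
      (trans (B-on-shapes a c) (trans (B-cong (sym ∘ u-shape) (sym ∘ y-shape)) Buy≡0))
      (trans (B-on-shapes b d) (trans (B-cong (sym ∘ z-shape) (sym ∘ y-shape)) Bzy≡0))
      where
      B-on-shapes : ∀ x x′ → x * x * y 3F + x′ * x′ * y 0F + σ * (x * x′) ≡
                             B (vec (x * x) (x * x′) 0# (x′ * x′)) (vec (y 0F) (y 1F) 1# (y 3F))
      B-on-shapes x x′ = solve 6 (λ σ x x′ y₀ y₁ y₃ → x :* x :* y₃ :+ x′ :* x′ :* y₀ :+ σ :* (x :* x′)
                                    := Bₚ σ (vecₚ (x :* x) (x :* x′) 0ₚ (x′ :* x′)) (vecₚ y₀ y₁ 1ₚ y₃))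
                           refl σ x x′ (y 0F) (y 1F) (y 3F)

    t : F
    t = y 1F + σ * b * c

    M≡gtMat : ∀ i k → M i k ≡ gtMat a b c d t i k
    M≡gtMat 0F 0F = sym a²
    M≡gtMat 1F 0F = u₁≡ac
    M≡gtMat 2F 0F = u₂≡0
    M≡gtMat 3F 0F = sym c²
    M≡gtMat 0F 1F = v₀≡0
    M≡gtMat 1F 1F = v₁≡1
    M≡gtMat 2F 1F = v₂≡0
    M≡gtMat 3F 1F = v₃≡0
    M≡gtMat 0F 2F = proj₁ y₀≡σab×y₃≡σcd
    M≡gtMat 1F 2F = sym (x+y+y≡x (y 1F) (σ * b * c))
    M≡gtMat 2F 2F = y₂≡1
    M≡gtMat 3F 2F = proj₂ y₀≡σab×y₃≡σcd
    M≡gtMat 0F 3F = sym b²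
    M≡gtMat 1F 3F = z₁≡bd
    M≡gtMat 2F 3F = z₂≡0
    M≡gtMat 3F 3F = sym d²

    decomposition : GParams a b c d × InGFq t × SameMap (act M e) (gtτ a b c d t e)
    decomposition = (a∈GFq , b∈GFq , c∈GFq , d∈GFq , ad+bc≡1) ,
                    InGFq-+ (M-rational 1F 2F) (InGFq-* (InGFq-* σ∈GFq b∈GFq) c∈GFq) ,
                    λ x _ → ≗⇒∼ λ i → trans (·-congᴹ M≡gtMat (frob e x) i) (sym (gMat-tMat≡gtMat a b c d t (frob e x) i))
      where
      a∈GFq : InGFq a
      a∈GFq = InGFq-√ (M-rational 0F 0F)
      b∈GFq : InGFq b
      b∈GFq = InGFq-√ (M-rational 0F 3F)
      c∈GFq : InGFq c
      c∈GFq = InGFq-√ (M-rational 3F 0F)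
      d∈GFq : InGFq d
      d∈GFq = InGFq-√ (M-rational 3F 3F)

  stabilizer-decomposition : ∀ {w} → w ≢ 0# → w ≢ 1# → ∀ (M : Mat) (e : Bool) → IsSymplecticGFq M →
    Stabilizes (act M e) ⇔
      Σ F (λ a → Σ F (λ b → Σ F (λ c → Σ F (λ d → Σ F (λ v → Σ Bool (λ e′ →
        GParams a b c d × InGFq v × SameMap (act M e) (gtτ a b c d v e′)))))))
  stabilizer-decomposition w≢0 w≢1 M e M-symplectic = mk⇔
    (λ M-stabilizes → let open StabilizerElement w≢0 w≢1 {e = e} M-symplectic M-stabilizes
                      in a , b , c , d , t , e , decomposition)
    (λ (_ , _ , _ , _ , v , e′ , (_ , _ , _ , _ , ad+bc≡1) , _ , same) →
       SameMap-stabilizes same (gtτ-stabilizes ad+bc≡1 v e′))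

  -- Uniqueness of the decomposition

  frob₁-injective-at : ∀ {w} → ¬ InGFq w → ∀ e e′ → frob₁ e w ≡ frob₁ e′ w → e ≡ e′
  frob₁-injective-at w∉GFq false false _ = refl
  frob₁-injective-at w∉GFq true true _ = refl
  frob₁-injective-at w∉GFq false true w≡wq = contradiction (sym w≡wq) w∉GFq
  frob₁-injective-at w∉GFq true false wq≡w = contradiction wq≡w w∉GFq

  nonzero-pair : ∀ {x y p r} → x * p + r * y ≡ 1# → x ≢ 0# ⊎ y ≢ 0#
  nonzero-pair {x} {y} {p} {r} xp+ry≡1 with x ≟ 0# | y ≟ 0#
  ... | no x≢0 | _ = inj₁ x≢0
  ... | yes _ | no y≢0 = inj₂ y≢0
  ... | yes refl | yes refl = contradiction (trans (sym xp+ry≡1) (trans (cong₂ _+_ (zeroˡ p) (zeroʳ r)) (+-identityʳ 0#))) 1≢0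

  same-scalar : ∀ {x y x′ y′ l m} → x′ ≢ 0# ⊎ y′ ≢ 0# →
    x * x ≡ l * (x′ * x′) → y * y ≡ l * (y′ * y′) → x * x ≡ m * (x′ * x′) → y * y ≡ m * (y′ * y′) → l ≡ m
  same-scalar (inj₁ x′≢0) x²≡lx′² _ x²≡mx′² _ = *-cancelʳ-nonzero (square-≢0 x′≢0) (trans (sym x²≡lx′²) x²≡mx′²)
  same-scalar (inj₂ y′≢0) _ y²≡ly′² _ y²≡my′² = *-cancelʳ-nonzero (square-≢0 y′≢0) (trans (sym y²≡ly′²) y²≡my′²)

  -- The hypotheses are rows 0, 1, 3 of the images under gtMat of E k and of E 1F + E k, for k = 0F or 3F.
  pair-determined : ∀ {x y x′ y′ l m} → x′ ≢ 0# ⊎ y′ ≢ 0# →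
    x * x ≡ l * (x′ * x′) → x * y ≡ l * (x′ * y′) → y * y ≡ l * (y′ * y′) →
    0# + x * x ≡ m * (0# + x′ * x′) → 1# + x * y ≡ m * (1# + x′ * y′) → 0# + y * y ≡ m * (0# + y′ * y′) →
    x ≡ x′ × y ≡ y′
  pair-determined {x} {y} {x′} {y′} {l} {m} nonzero x²≡ xy≡ y²≡ x²≡′ xy≡′ y²≡′ =
    square-injective (trans x²≡ (trans (cong (_* (x′ * x′)) l≡1) (*-identityˡ _))) ,
    square-injective (trans y²≡ (trans (cong (_* (y′ * y′)) l≡1) (*-identityˡ _)))
    where
    strip : ∀ {u u′} → 0# + u ≡ m * (0# + u′) → u ≡ m * u′
    strip {u} {u′} eq = trans (sym (+-identityˡ u)) (trans eq (cong (m *_) (+-identityˡ u′)))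
    l≡m : l ≡ m
    l≡m = same-scalar nonzero x²≡ y²≡ (strip x²≡′) (strip y²≡′)
    l≡1 : l ≡ 1#
    l≡1 = trans l≡m (sym (+-cancelʳ (m * (x′ * y′)) 1# m (begin
      1# + m * (x′ * y′)       ≡⟨ cong (λ k → 1# + k * (x′ * y′)) l≡m ⟨
      1# + l * (x′ * y′)       ≡⟨ cong (1# +_) xy≡ ⟨
      1# + x * y               ≡⟨ xy≡′ ⟩
      m * (1# + x′ * y′)       ≡⟨ distribˡ m 1# (x′ * y′) ⟩
      m * 1# + m * (x′ * y′)   ≡⟨ cong (_+ m * (x′ * y′)) (*-identityʳ m) ⟩
      m + m * (x′ * y′)        ∎)))
      where open ≡-Reasoning

  ·-E₁+E₀ : ∀ M → M · vec 1# 1# 0# 0# ≗ λ i → M i 1F + M i 0F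
  ·-E₁+E₀ M i = solve 4 (λ m₀ m₁ m₂ m₃ → m₀ :* 1ₚ :+ m₁ :* 1ₚ :+ m₂ :* 0ₚ :+ m₃ :* 0ₚ := m₁ :+ m₀)
    refl (M i 0F) (M i 1F) (M i 2F) (M i 3F)

  ·-E₁+E₃ : ∀ M → M · vec 0# 1# 0# 1# ≗ λ i → M i 1F + M i 3F
  ·-E₁+E₃ M i = solve 4 (λ m₀ m₁ m₂ m₃ → m₀ :* 0ₚ :+ m₁ :* 1ₚ :+ m₂ :* 0ₚ :+ m₃ :* 1ₚ := m₁ :+ m₃)
    refl (M i 0F) (M i 1F) (M i 2F) (M i 3F)

  ·-line : ∀ M s → M · vec 1# s 0# 0# ≗ λ i → M i 0F + s * M i 1F
  ·-line M s i = solve 5 (λ m₀ m₁ m₂ m₃ s → m₀ :* 1ₚ :+ m₁ :* s :+ m₂ :* 0ₚ :+ m₃ :* 0ₚ := m₀ :+ s :* m₁)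
    refl (M i 0F) (M i 1F) (M i 2F) (M i 3F) s

  frob-line : ∀ e t → frob e (vec 1# t 0# 0#) ≗ vec 1# (frob₁ e t) 0# 0#
  frob-line false t i = refl
  frob-line true t 0F = InGFq-1
  frob-line true t 1F = refl
  frob-line true t 2F = InGFq-0
  frob-line true t 3F = InGFq-0

  module Uniqueness {a b c d v a′ b′ c′ d′ v′ : F} {e e′ : Bool} (a′d′+b′c′≡1 : a′ * d′ + b′ * c′ ≡ 1#)
                    (same : SameMap (gtτ a b c d v e) (gtτ a′ b′ c′ d′ v′ e′)) where
    G G′ : Mat
    G = gtMat a b c d v
    G′ = gtMat a′ b′ c′ d′ v′

    proportional : ∀ {x f f′} → G · x ≗ f → G′ · x ≗ f′ → NonZero x → (∀ i → InGFq (x i)) →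
                   ∃[ l ] (∀ i → f i ≡ l * f′ i)
    proportional {x} G·x≗f G′·x≗f′ x≢0 x∈GFq =
      let (l , _ , gtτx≡lgtτ′x) = same x x≢0 in l , λ i → begin
        _                           ≡⟨ G·x≗f i ⟨
        (G · x) i                   ≡⟨ gtτ-rational a b c d v e x∈GFq i ⟨
        gtτ a b c d v e x i         ≡⟨ gtτx≡lgtτ′x i ⟩
        l * gtτ a′ b′ c′ d′ v′ e′ x i ≡⟨ cong (l *_) (trans (gtτ-rational a′ b′ c′ d′ v′ e′ x∈GFq i) (G′·x≗f′ i)) ⟩
        _                           ∎
      where open ≡-Reasoning

    column-proportional : ∀ k → ∃[ l ] (∀ i → G i k ≡ l * G′ i k)
    column-proportional k = proportional (·-E G k) (·-E G′ k) (E-nonzero k) (E-rational k)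

    E₁+E₀-proportional : ∃[ m ] (∀ i → G i 1F + G i 0F ≡ m * (G′ i 1F + G′ i 0F))
    E₁+E₀-proportional = proportional (·-E₁+E₀ G) (·-E₁+E₀ G′) (λ x≡0 → 1≢0 (x≡0 1F))
                                      (vec-rational InGFq-1 InGFq-1 InGFq-0 InGFq-0)

    E₁+E₃-proportional : ∃[ m ] (∀ i → G i 1F + G i 3F ≡ m * (G′ i 1F + G′ i 3F))
    E₁+E₃-proportional = proportional (·-E₁+E₃ G) (·-E₁+E₃ G′) (λ x≡0 → 1≢0 (x≡0 1F))
                                      (vec-rational InGFq-0 InGFq-1 InGFq-0 InGFq-1)

    a≡a′×c≡c′ : a ≡ a′ × c ≡ c′
    a≡a′×c≡c′ =
      let (l , col) = column-proportional 0F
          (m , col′) = E₁+E₀-proportional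
      in pair-determined (nonzero-pair a′d′+b′c′≡1)
           (col 0F) (col 1F) (col 3F) (col′ 0F) (col′ 1F) (col′ 3F)

    b≡b′×d≡d′ : b ≡ b′ × d ≡ d′
    b≡b′×d≡d′ =
      let (l , col) = column-proportional 3F
          (m , col′) = E₁+E₃-proportional
      in pair-determined (nonzero-pair (trans (+-comm _ _) a′d′+b′c′≡1))
           (col 0F) (col 1F) (col 3F) (col′ 0F) (col′ 1F) (col′ 3F)

    v≡v′ : v ≡ v′
    v≡v′ =
      let (l , col) = column-proportional 2F
          l≡1 = trans (sym (*-identityʳ l)) (sym (col 2F))
      in +-cancelʳ (σ * b * c) v v′ (begin
        v + σ * b * c               ≡⟨ col 1F ⟩
        l * (v′ + σ * b′ * c′)      ≡⟨ cong (_* (v′ + σ * b′ * c′)) l≡1 ⟩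
        1# * (v′ + σ * b′ * c′)     ≡⟨ *-identityˡ _ ⟩
        v′ + σ * b′ * c′            ≡⟨ cong₂ (λ x y → v′ + σ * x * y) (proj₁ b≡b′×d≡d′) (proj₂ a≡a′×c≡c′) ⟨
        v′ + σ * b * c              ∎)
      where open ≡-Reasoning

  -- τ moves the point (1, w, 0, 0) off GF(q) while g t fixes its GF(q)-part.
  exponent-unique : ∀ {w} → ¬ InGFq w → ∀ {a b c d v e e′} → a * d + b * c ≡ 1# →
                    SameMap (gtτ a b c d v e) (gtτ a b c d v e′) → e ≡ e′
  exponent-unique {w} w∉GFq {a} {b} {c} {d} {v} {e} {e′} ad+bc≡1 same =
    let (l , _ , eq) = same (vec 1# w 0# 0#) (λ x≡0 → 1≢0 (x≡0 0F))
        row : ∀ i → G i 0F + frob₁ e w * G i 1F ≡ l * (G i 0F + frob₁ e′ w * G i 1F)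
        row i = trans (sym (image e i)) (trans (eq i) (cong (l *_) (image e′ i)))
        l≡1 : l ≡ 1#
        l≡1 = same-scalar (nonzero-pair ad+bc≡1) (strip (row 0F)) (strip (row 3F))
                (sym (*-identityˡ (a * a))) (sym (*-identityˡ (c * c)))
    in frob₁-injective-at w∉GFq e e′ (+-cancelˡ (a * c) _ _ (begin
      a * c + frob₁ e w                 ≡⟨ cong (a * c +_) (*-identityʳ _) ⟨
      a * c + frob₁ e w * 1#            ≡⟨ row 1F ⟩
      l * (a * c + frob₁ e′ w * 1#)     ≡⟨ cong (_* (a * c + frob₁ e′ w * 1#)) l≡1 ⟩
      1# * (a * c + frob₁ e′ w * 1#)    ≡⟨ *-identityˡ _ ⟩
      a * c + frob₁ e′ w * 1#           ≡⟨ cong (a * c +_) (*-identityʳ _) ⟩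
      a * c + frob₁ e′ w                ∎))
    where
    open ≡-Reasoning
    G = gtMat a b c d v
    image : ∀ e i → gtτ a b c d v e (vec 1# w 0# 0#) i ≡ G i 0F + frob₁ e w * G i 1F
    image e i = trans (gMat-tMat≡gtMat a b c d v (frob e (vec 1# w 0# 0#)) i)
                      (trans (·-congˡ G (frob-line e w) i) (·-line G (frob₁ e w) i))
    strip : ∀ {x s s′ l} → x + s * 0# ≡ l * (x + s′ * 0#) → x ≡ l * x
    strip {x} {s} {s′} {l} eq = trans (sym (x+y*0≡x x s)) (trans eq (cong (l *_) (x+y*0≡x x s′)))

  decomposition-unique : ∀ {w} → ¬ InGFq w → ∀ {a b c d v e a′ b′ c′ d′ v′ e′} → a′ * d′ + b′ * c′ ≡ 1# →
    SameMap (gtτ a b c d v e) (gtτ a′ b′ c′ d′ v′ e′) →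
    SameMap (gMat a b c d ·_) (gMat a′ b′ c′ d′ ·_) × SameMap (tMat v ·_) (tMat v′ ·_) × e ≡ e′
  decomposition-unique w∉GFq {e = e} {e′ = e′} a′d′+b′c′≡1 same =
    from-equal-parameters a≡a′×c≡c′ b≡b′×d≡d′ v≡v′ a′d′+b′c′≡1 same
    where
    open Uniqueness {e = e} {e′ = e′} a′d′+b′c′≡1 same
    from-equal-parameters : ∀ {a b c d v e a′ b′ c′ d′ v′ e′} →
      a ≡ a′ × c ≡ c′ → b ≡ b′ × d ≡ d′ → v ≡ v′ → a′ * d′ + b′ * c′ ≡ 1# →
      SameMap (gtτ a b c d v e) (gtτ a′ b′ c′ d′ v′ e′) →
      SameMap (gMat a b c d ·_) (gMat a′ b′ c′ d′ ·_) × SameMap (tMat v ·_) (tMat v′ ·_) × e ≡ e′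
    from-equal-parameters (refl , refl) (refl , refl) refl ad+bc≡1 same′ =
      SameMap-refl , SameMap-refl , exponent-unique w∉GFq ad+bc≡1 same′

open import Data.Nat using (_*_)

mainTheorem7 :
  (q : ℕ) → 2 ∣ q → (K : Field) → HasSize K (q * q) →
  let open Field K renaming (Carrier to F) using () in
  let open Geometry K q in
  (σ : F) → InGFq σ → IrreducibleOverGFq σ →
  let open WithSigma σ in
  -- G and T lie in PSp(4,q)
  (∀ a b c d → GParams a b c d → IsSymplecticGFq (gMat a b c d))
  × (∀ v → InGFq v → IsSymplecticGFq (tMat v))
  -- G, T and {1,τ} commute elementwise
  × (∀ a b c d v → GParams a b c d → InGFq v →
       SameMap (λ x → gMat a b c d · (tMat v · x)) (λ x → tMat v · (gMat a b c d · x)))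
  × (∀ a b c d → GParams a b c d →
       SameMap (λ x → gMat a b c d · frob true x) (λ x → frob true (gMat a b c d · x)))
  × (∀ v → InGFq v →
       SameMap (λ x → tMat v · frob true x) (λ x → frob true (tMat v · x)))
  -- the stabilizer of C in ⟨PSp(4,q), τ⟩ is exactly { g t τ^e }
  × (∀ (M : Mat) (e : Bool) → IsSymplecticGFq M →
       Stabilizes (act M e) ⇔
         Σ F (λ a → Σ F (λ b → Σ F (λ c → Σ F (λ d → Σ F (λ v → Σ Bool (λ e′ →
           GParams a b c d × InGFq v × SameMap (act M e) (gtτ a b c d v e′))))))))
  -- and the product is direct: the decomposition g t τ^e is unique
  × (∀ a b c d v e a′ b′ c′ d′ v′ e′ →
       GParams a b c d → InGFq v → GParams a′ b′ c′ d′ → InGFq v′ →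
       SameMap (gtτ a b c d v e) (gtτ a′ b′ c′ d′ v′ e′) →
       SameMap (gMat a b c d ·_) (gMat a′ b′ c′ d′ ·_)
       × SameMap (tMat v ·_) (tMat v′ ·_)
       × e ≡ e′)
mainTheorem7 q 2∣q K enumeration σ σ∈GFq irreducible =
  (λ _ _ _ _ → gMat-symplectic) ,
  (λ _ → tMat-symplectic) ,
  (λ a b c d v _ _ x _ → ≗⇒∼ (gMat-tMat-comm a b c d v x)) ,
  (λ _ _ _ _ params x _ → ≗⇒∼ (rational-commutes-with-frob (gMat-rational params) x)) ,
  (λ _ v∈GFq x _ → ≗⇒∼ (rational-commutes-with-frob (tMat-rational v∈GFq) x)) ,
  stabilizer-decomposition w≢0 w≢1 ,
  (λ { _ _ _ _ _ _ _ _ _ _ _ _ _ _ (_ , _ , _ , _ , a′d′+b′c′≡1) _ → decomposition-unique w∉GFq a′d′+b′c′≡1 })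
  where
  open Field K renaming (Carrier to F)
  open IsCommutativeRing isCommutativeRing using (*-identityˡ)
  open Enumerated K enumeration
  open Geometry K q using (InGFq)

  char2 : 1# + 1# ≡ 0#
  char2 = even-size⇒char2 (∣m⇒∣m*n q 2∣q)

  q≡2^1+j : ∃[ j ] q ≡ 2 ℕ.^ suc j
  q≡2^1+j = even-*-self≡2^ 2∣q (char2⇒size≡2^ char2)

  open Frobenius K char2 _≟_ q (proj₁ q≡2^1+j) (proj₂ q≡2^1+j)

  -- In characteristic two, x² + 0x + 1 = (x + 1)(x + 1).
  σ≢0 : σ ≢ 0#
  σ≢0 σ≡0 = irreducible 1# 1# InGFq-1 InGFq-1 (trans char2 (sym σ≡0) , *-identityˡ 1#)

  open Collineations K char2 _≟_ q (proj₁ q≡2^1+j) (proj₂ q≡2^1+j) σ σ∈GFq σ≢0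

  w : F
  w = proj₁ (∃-non-GFq enumeration)

  w∉GFq : ¬ InGFq w
  w∉GFq = proj₂ (∃-non-GFq enumeration)

  w≢0 : w ≢ 0#
  w≢0 w≡0 = w∉GFq (subst InGFq (sym w≡0) InGFq-0)

  w≢1 : w ≢ 1#
  w≢1 w≡1 = w∉GFq (subst InGFq (sym w≡1) InGFq-1)
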